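{- For every deterministic online algorithm $ALG$ for the online dominating set problem (in the model described in the context), $\rho(ALG, \mathrm{TREE}) \geq 2$; that is, no such algorithm has asymptotic competitive ratio smaller than $2$ when the input graphs are restricted to trees.
   Context: Online dominating set model: an input is a finite, connected, simple, undirected graph $G=(V,E)$ together with an ordering $v_1,\dots,v_n$ of $V$ (the revelation order), both chosen by an adversary subject to the constraint that for every $i$ the subgraph induced on $\{v_1,\dots,v_i\}$ is connected. At step $i$ the vertex $v_i$ is revealed together with its entire closed neighbourhood $N[v_i]$ (including neighbours not yet revealed), and the online algorithm must irrevocably decide, before step $i+1$, whether to include $v_i$ in its solution. The final set of selected vertices must be a dominating set of $G$ (every vertex is selected or adjacent to a selected vertex). The algorithm does not know $G$ or $n$ in advance. $ALG$ denotes the number of vertices selected by the algorithm and $OPT$ the size of a minimum dominating set of $G$. For a class CLASS of graphs, $ALG$ is $c$-competitive on CLASS if $\limsup_{OPT\to\infty} ALG/OPT \le c$ over inputs whose graph lies in CLASS, and $\rho(ALG,\mathrm{CLASS})$ (the asymptotic competitive ratio) is the infimum of all such $c$. TREE is the class of trees. -}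

module Defs where

open import Data.Nat using (ℕ; zero; suc; _+_; _*_; _≤_; _<_; _≥_)
open import Data.Nat.Properties using (≤-decTotalOrder; _≤?_)
open import Data.Bool using (Bool; true; false; _∨_)
open import Data.Fin using (Fin; toℕ; _≟_)
open import Data.Fin.Subset using (Subset; _∈_; ∣_∣)
open import Data.List using (List; []; _∷_; map; filter; allFin; length)
open import Data.List.Relation.Unary.AllPairs using (AllPairs)
open import Data.List.Relation.Unary.Linked using (Linked)
open import Data.List.Sort ≤-decTotalOrder using (sort)
open import Data.Vec using (tabulate)
open import Data.Product using (Σ; _×_; _,_; ∃)
open import Data.Sum using (_⊎_)
open import Relation.Binary.PropositionalEquality using (_≡_; _≢_)
open import Relation.Nullary using (¬_; does)
open import Function.Definitions using (Injective)

record Graph : Set where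
  field
    n      : ℕ
    adj    : Fin n → Fin n → Bool
    sym    : ∀ i j → adj i j ≡ adj j i
    irrefl : ∀ i → adj i i ≡ false

module _ (G : Graph) where
  open Graph G

  Adj : Fin n → Fin n → Set
  Adj i j = adj i j ≡ true

  data WalkIn (P : Fin n → Set) : Fin n → Fin n → Set where
    here : ∀ {a} → P a → WalkIn P a a
    step : ∀ {a b c} → P a → Adj a b → WalkIn P b c → WalkIn P a c

  ConnectedOn : (Fin n → Set) → Set
  ConnectedOn P = ∀ a b → P a → P b → WalkIn P a b

  Connected : Set
  Connected = ∀ (a b : Fin n) → WalkIn (λ _ → Fin n) a b

  IsCycle : List (Fin n) → Set
  IsCycle [] = Data.Empty.⊥
    where import Data.Empty
  IsCycle (x ∷ xs) =
    (3 ≤ length (x ∷ xs)) × AllPairs _≢_ (x ∷ xs) × Linked Adj (x ∷ xs)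
      × LastAdj x (x ∷ xs)
    where
    LastAdj : Fin n → List (Fin n) → Set
    LastAdj f [] = Data.Empty.⊥
      where import Data.Empty
    LastAdj f (y ∷ []) = Adj y f
    LastAdj f (y ∷ z ∷ zs) = LastAdj f (z ∷ zs)

  IsTree : Set
  IsTree = Connected × (∀ (xs : List (Fin n)) → ¬ IsCycle xs)

  Dominating : Subset n → Set
  Dominating S = ∀ v → v ∈ S ⊎ Σ (Fin n) (λ u → u ∈ S × Adj u v)

  IsOPT : ℕ → Set
  IsOPT k = Σ (Subset n) (λ S → Dominating S × ∣ S ∣ ≡ k)
            × (∀ S → Dominating S → k ≤ ∣ S ∣)

-- Vertex i : Fin n is the (i+1)-st
-- revealed vertex; the adversary also fixes injective names (labels)
-- in ℕ, which are all the algorithm ever sees about vertex identities.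

record Input : Set where
  field
    graph     : Graph
  open Graph graph public
  field
    label     : Fin n → ℕ
    label-inj : Injective _≡_ _≡_ label
    prefix-connected : ∀ (i : ℕ) → ConnectedOn graph (λ v → toℕ v < i)

-- What is revealed about vertex i: its name and the (sorted, hence
-- canonical) list of names of its closed neighbourhood N[v_i].
Observation : Set
Observation = ℕ × List ℕ

module _ (I : Input) where
  open Input I

  closedNbrs : Fin n → List (Fin n)
  closedNbrs i = filter (λ j → does (i ≟ j) ∨ adj i j ≟b true) (allFin n)
    where
    open import Data.Bool.Properties renaming (_≟_ to _≟b_)
    open import Relation.Nullary.Decidable using (Dec)

  observe : Fin n → Observation
  observe i = label i , sort (map label (closedNbrs i))

  history : Fin n → List Observation
  history i = map observe (filter (λ j → toℕ j ≤? toℕ i) (allFin n))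

-- A deterministic online algorithm: decides on the current (last)
-- vertex from everything revealed so far (its own earlier decisions
-- are determined by earlier histories).
OnlineAlg : Set
OnlineAlg = List Observation → Bool

algSet : OnlineAlg → (I : Input) → Subset (Input.n I)
algSet A I = tabulate (λ i → A (history I i))

ALG : OnlineAlg → Input → ℕ
ALG A I = ∣ algSet A I ∣

Correct : OnlineAlg → Set
Correct A = ∀ I → Dominating (Input.graph I) (algSet A I)

-- The adversary reveals a tree in breadth-first order, numbering vertices by revelation time.
-- The root has a leaf and K query children. A query that the algorithm accepts while fewer than
-- B queries have been accepted gets a fork (a vertex with two leaves) and a new query as children;
-- any other query gets two leaves. Every query has two children, so what the algorithm sees does
-- not depend on its answer.
--   The internal vertices other than the G grown queries form a dominating set of size 1 + K + G,
-- and it is minimum: each of them has a leaf child, which must be dominated by itself or its parent.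
-- The algorithm pays for every internal vertex (itself or a leaf below it) and twice for each of
-- its R rejected queries, whose two leaves it must take: ALG ≥ 1 + K + 2G + R. If the budget is
-- never exhausted, each query is grown or rejected, so R = K and ALG ≥ 2 OPT - 1; otherwise
-- G ≥ B and ALG ≥ OPT + G. With K = M + m + 1 and B = (m + 1)(K + 1) both give
-- ALG / OPT > 2 - 1/(m + 1), while OPT ≥ M.

module Submission where

open import Defs
open import Algebra.Properties.CommutativeSemigroup using (interchange)
open import Data.Bool using (Bool; true; false; _∨_; _∧_; not)
import Data.Bool.Properties
open import Data.Empty using (⊥; ⊥-elim)
open import Data.Fin using (Fin; toℕ; fromℕ<) renaming (_<_ to _<ᶠ_)
import Data.Fin as Fin
open import Data.Fin.Properties using (toℕ-injective; toℕ<n; toℕ-fromℕ<; fromℕ<-toℕ)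
open import Data.Fin.Subset using (Subset; ∣_∣) renaming (_∈_ to _∈ˢ_)
open import Data.List using (List; []; _∷_; length; map; filter; upTo; applyUpTo; allFin; tabulate; _++_; replicate)
import Data.List.Properties
open import Data.List.Membership.Propositional using (_∈_)
open import Data.List.Membership.Propositional.Properties
  using (∈-filter⁺; ∈-filter⁻; ∈-upTo⁺; ∈-upTo⁻; ∈-applyUpTo⁺; ∈-applyUpTo⁻)
open import Data.List.Relation.Unary.All as All using (All; []; _∷_)
import Data.List.Relation.Unary.All.Properties as All
open import Data.List.Relation.Unary.AllPairs using (AllPairs; []; _∷_)
import Data.List.Relation.Unary.AllPairs.Properties as AllPairs
open import Data.List.Relation.Unary.Any using (here; there)
open import Data.List.Relation.Unary.Linked as Linked using (Linked; []; [-]; _∷_)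
open import Data.Maybe using (Maybe; just; nothing)
open import Data.Nat
open import Data.Nat.Induction using (<-wellFounded)
open import Data.Nat.ListAction using (sum)
open import Data.Nat.ListAction.Properties using (sum-++)
open import Data.Nat.Properties
open import Data.List.Sort ≤-decTotalOrder using (sort)
open import Data.Nat.Tactic.RingSolver using (solve-∀)
open import Data.Product using (Σ; ∃-syntax; _×_; _,_; proj₁; proj₂)
import Data.Product
open import Data.Sum using (_⊎_; inj₁; inj₂)
import Data.Sum
import Data.Vec as Vec
import Data.Vec.Properties as Vec
open import Function using (_∘_; case_of_)
open import Function.Bundles using (mk⇔; Equivalence)
open import Induction.WellFounded using (Acc; acc)
open import Relation.Binary using (tri<; tri≈; tri>)
open import Relation.Binary.PropositionalEquality
open import Relation.Nullary using (¬_; Dec; yes; no; does; contradiction)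
open import Relation.Nullary.Decidable using (_×-dec_; dec-true; dec-false; does-⇔)
open import Relation.Unary using (Decidable)

OnRange : ℕ → ℕ → (ℕ → Set) → Set
OnRange a l P = ∀ k → a ≤ k → k < a + l → P k

OnRange-head : ∀ {a l P} → OnRange a (suc l) P → P a
OnRange-head {a} h = h a ≤-refl (m<m+n a z<s)

OnRange-tail : ∀ {a l P} → OnRange a (suc l) P → OnRange (suc a) l P
OnRange-tail {a} {l} h k a<k k<1+a+l = h k (<⇒≤ a<k) (subst (k <_) (sym (+-suc a l)) k<1+a+l)

∑ : ℕ → ℕ → (ℕ → ℕ) → ℕ
∑ a zero    g = 0
∑ a (suc l) g = g a + ∑ (suc a) l g

∑-++ : ∀ a l₁ l₂ g → ∑ a (l₁ + l₂) g ≡ ∑ a l₁ g + ∑ (a + l₁) l₂ g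
∑-++ a zero    l₂ g = cong (λ b → ∑ b l₂ g) (sym (+-identityʳ a))
∑-++ a (suc l₁) l₂ g = begin
  g a + ∑ (suc a) (l₁ + l₂) g                  ≡⟨ cong (g a +_) (∑-++ (suc a) l₁ l₂ g) ⟩
  g a + (∑ (suc a) l₁ g + ∑ (suc a + l₁) l₂ g) ≡⟨ sym (+-assoc (g a) _ _) ⟩
  g a + ∑ (suc a) l₁ g + ∑ (suc a + l₁) l₂ g   ≡⟨ cong (λ b → g a + ∑ (suc a) l₁ g + ∑ b l₂ g) (sym (+-suc a l₁)) ⟩
  g a + ∑ (suc a) l₁ g + ∑ (a + suc l₁) l₂ g   ∎
  where open ≡-Reasoning

∑-cong : ∀ a l {g h} → OnRange a l (λ k → g k ≡ h k) → ∑ a l g ≡ ∑ a l h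
∑-cong a zero    eq = refl
∑-cong a (suc l) eq = cong₂ _+_ (OnRange-head eq) (∑-cong (suc a) l (OnRange-tail eq))

∑-mono-≤ : ∀ a l {g h} → OnRange a l (λ k → g k ≤ h k) → ∑ a l g ≤ ∑ a l h
∑-mono-≤ a zero    le = z≤n
∑-mono-≤ a (suc l) le = +-mono-≤ (OnRange-head le) (∑-mono-≤ (suc a) l (OnRange-tail le))

∑-distrib-+ : ∀ a l g h → ∑ a l (λ k → g k + h k) ≡ ∑ a l g + ∑ a l h
∑-distrib-+ a zero    g h = refl
∑-distrib-+ a (suc l) g h =
  trans (cong (g a + h a +_) (∑-distrib-+ (suc a) l g h)) (interchange +-commutativeSemigroup (g a) (h a) _ _)

∑-zero : ∀ a l {g} → OnRange a l (λ k → g k ≡ 0) → ∑ a l g ≡ 0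
∑-zero a zero    eq = refl
∑-zero a (suc l) eq = cong₂ _+_ (OnRange-head eq) (∑-zero (suc a) l (OnRange-tail eq))

∑-shift : ∀ a l g → ∑ a l (λ k → g (suc k)) ≡ ∑ (suc a) l g
∑-shift a zero    g = refl
∑-shift a (suc l) g = cong (g (suc a) +_) (∑-shift (suc a) l g)

∑-head-≤ : ∀ a l g → 0 < l → g a ≤ ∑ a l g
∑-head-≤ a (suc l) g _ = m≤m+n (g a) _

∑-blocks : ∀ (s c g : ℕ → ℕ) a J → OnRange a J (λ j → s (suc j) ≡ s j + c j) →
           ∑ a J (λ j → ∑ (s j) (c j) g) ≡ ∑ (s a) (∑ a J c) g
∑-blocks s c g a zero    tiles = refl
∑-blocks s c g a (suc J) tiles = begin
  ∑ (s a) (c a) g + ∑ (suc a) J (λ j → ∑ (s j) (c j) g) ≡⟨ cong (_ +_) (∑-blocks s c g (suc a) J (OnRange-tail tiles)) ⟩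
  ∑ (s a) (c a) g + ∑ (s (suc a)) (∑ (suc a) J c) g     ≡⟨ cong (λ b → ∑ (s a) (c a) g + ∑ b (∑ (suc a) J c) g) (OnRange-head tiles) ⟩
  ∑ (s a) (c a) g + ∑ (s a + c a) (∑ (suc a) J c) g     ≡⟨ sym (∑-++ (s a) (c a) _ g) ⟩
  ∑ (s a) (c a + ∑ (suc a) J c) g                       ∎
  where open ≡-Reasoning

blocks-end : ∀ (s c : ℕ → ℕ) a J → OnRange a J (λ j → s (suc j) ≡ s j + c j) →
             s (a + J) ≡ s a + ∑ a J c
blocks-end s c a zero    tiles = trans (cong s (+-identityʳ a)) (sym (+-identityʳ (s a)))
blocks-end s c a (suc J) tiles = begin
  s (a + suc J)                ≡⟨ cong s (+-suc a J) ⟩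
  s (suc a + J)                ≡⟨ blocks-end s c (suc a) J (OnRange-tail tiles) ⟩
  s (suc a) + ∑ (suc a) J c    ≡⟨ cong (_+ _) (OnRange-head tiles) ⟩
  s a + c a + ∑ (suc a) J c    ≡⟨ +-assoc (s a) (c a) _ ⟩
  s a + (c a + ∑ (suc a) J c)  ∎
  where open ≡-Reasoning

𝟙 : Bool → ℕ
𝟙 true  = 1
𝟙 false = 0

does-true : ∀ {A : Set} (a? : Dec A) → does a? ≡ true → A
does-true (yes a) _ = a

∨-≡-true : ∀ a b → a ∨ b ≡ true → a ≡ true ⊎ b ≡ true
∨-≡-true true  _ _    = inj₁ refl
∨-≡-true false _ b≡t = inj₂ b≡t

∧-true : ∀ a b → a ∧ b ≡ true → a ≡ true × b ≡ true
∧-true true true _ = refl , refl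

∧-not-false : ∀ a b → a ∧ not b ≡ false → a ≡ false ⊎ b ≡ true
∧-not-false false _     _ = inj₁ refl
∧-not-false true  true  _ = inj₂ refl

𝟙-split : ∀ l x → 𝟙 x ≡ 𝟙 (l ∧ x) + 𝟙 (not l ∧ x)
𝟙-split true  x = sym (+-identityʳ (𝟙 x))
𝟙-split false x = refl

∣∷∣ : ∀ {n} x (p : Subset n) → ∣ x Vec.∷ p ∣ ≡ 𝟙 x + ∣ p ∣
∣∷∣ true  p = refl
∣∷∣ false p = refl

∣tabulate∣≡∑ : ∀ n (g : ℕ → Bool) → ∣ Vec.tabulate {n = n} (λ v → g (toℕ v)) ∣ ≡ ∑ 0 n (λ k → 𝟙 (g k))
∣tabulate∣≡∑ zero    g = refl
∣tabulate∣≡∑ (suc n) g = begin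
  ∣ g 0 Vec.∷ Vec.tabulate {n = n} (λ v → g (suc (toℕ v))) ∣ ≡⟨ ∣∷∣ (g 0) (Vec.tabulate {n = n} (λ v → g (suc (toℕ v)))) ⟩
  𝟙 (g 0) + ∣ Vec.tabulate {n = n} (λ v → g (suc (toℕ v))) ∣ ≡⟨ cong (𝟙 (g 0) +_) (∣tabulate∣≡∑ n (λ k → g (suc k))) ⟩
  𝟙 (g 0) + ∑ 0 n (λ k → 𝟙 (g (suc k)))              ≡⟨ cong (𝟙 (g 0) +_) (∑-shift 0 n (λ k → 𝟙 (g k))) ⟩
  𝟙 (g 0) + ∑ 1 n (λ k → 𝟙 (g k))                    ∎
  where open ≡-Reasoning

-- Indices from n on are reported as non-members.
member : ∀ {n} → Subset n → ℕ → Bool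
member {n} S k with k <? n
... | yes k<n = Vec.lookup S (fromℕ< k<n)
... | no  _   = false

member-toℕ : ∀ {n} (S : Subset n) v → member S (toℕ v) ≡ Vec.lookup S v
member-toℕ {n} S v with toℕ v <? n
... | yes v<n = cong (Vec.lookup S) (fromℕ<-toℕ v v<n)
... | no  v≮n = ⊥-elim (v≮n (toℕ<n v))

∣S∣≡∑member : ∀ {n} (S : Subset n) → ∣ S ∣ ≡ ∑ 0 n (λ k → 𝟙 (member S k))
∣S∣≡∑member {n} S = begin
  ∣ S ∣                                        ≡⟨ cong ∣_∣ (sym (Vec.tabulate∘lookup S)) ⟩
  ∣ Vec.tabulate {n = n} (Vec.lookup S) ∣              ≡⟨ cong ∣_∣ (Vec.tabulate-cong (λ v → sym (member-toℕ S v))) ⟩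
  ∣ Vec.tabulate {n = n} (λ v → member S (toℕ v)) ∣    ≡⟨ ∣tabulate∣≡∑ n (member S) ⟩
  ∑ 0 n (λ k → 𝟙 (member S k))                 ∎
  where open ≡-Reasoning

∈⇒member : ∀ {n} (S : Subset n) v → v ∈ˢ S → member S (toℕ v) ≡ true
∈⇒member S v v∈S = trans (member-toℕ S v) (Vec.[]=⇒lookup v∈S)

<-head⇒∉ : ∀ {x y ys} → x < y → All (y <_) ys → ¬ x ∈ y ∷ ys
<-head⇒∉ x<y _    (here x≡y)   = <-irrefl x≡y x<y
<-head⇒∉ x<y y<ys (there x∈ys) = <-asym x<y (All.lookup y<ys x∈ys)

strictlySorted-≡ : ∀ {xs ys : List ℕ} → AllPairs _<_ xs → AllPairs _<_ ys →
                   (∀ {z} → z ∈ xs → z ∈ ys) → (∀ {z} → z ∈ ys → z ∈ xs) → xs ≡ ys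
strictlySorted-≡ {[]}     {[]}     _ _ _ _ = refl
strictlySorted-≡ {[]}     {y ∷ ys} _ _ _ ys⊆xs with () ← ys⊆xs (here refl)
strictlySorted-≡ {x ∷ xs} {[]}     _ _ xs⊆ys _ with () ← xs⊆ys (here refl)
strictlySorted-≡ {x ∷ xs} {y ∷ ys} (x<xs ∷ sxs) (y<ys ∷ sys) xs⊆ys ys⊆xs with <-cmp x y
... | tri< x<y _ _ = ⊥-elim (<-head⇒∉ x<y y<ys (xs⊆ys (here refl)))
... | tri> _ _ y<x = ⊥-elim (<-head⇒∉ y<x x<xs (ys⊆xs (here refl)))
... | tri≈ _ refl _ = cong (x ∷_) (strictlySorted-≡ sxs sys (tail x<xs xs⊆ys) (tail y<ys ys⊆xs))
  where tail : ∀ {x zs ws} → All (x <_) zs → (∀ {z} → z ∈ x ∷ zs → z ∈ x ∷ ws) → ∀ {z} → z ∈ zs → z ∈ ws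
        tail x<zs zs⊆ws z∈zs with zs⊆ws (there z∈zs)
        ... | here refl = ⊥-elim (<-irrefl refl (All.lookup x<zs z∈zs))
        ... | there z∈ws = z∈ws

upTo-strictlySorted : ∀ n → AllPairs _<_ (upTo n)
upTo-strictlySorted n = AllPairs.applyUpTo⁺₁ (λ k → k) n (λ i<j _ → i<j)

_!_ : ∀ {A : Set} → List A → ℕ → Maybe A
[]       ! _     = nothing
(x ∷ xs) ! zero  = just x
(x ∷ xs) ! suc k = xs ! k

!-++ˡ : ∀ {A : Set} (xs ys : List A) {k e} → xs ! k ≡ just e → (xs ++ ys) ! k ≡ just e
!-++ˡ (x ∷ xs) ys {zero}  eq = eq
!-++ˡ (x ∷ xs) ys {suc k} eq = !-++ˡ xs ys eq

!-++ʳ : ∀ {A : Set} (xs ys : List A) k → (xs ++ ys) ! (length xs + k) ≡ ys ! k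
!-++ʳ []       ys k = refl
!-++ʳ (x ∷ xs) ys k = !-++ʳ xs ys k

!-map : ∀ {A C : Set} (f : A → C) xs {k x} → xs ! k ≡ just x → map f xs ! k ≡ just (f x)
!-map f (x ∷ xs) {zero}  refl = refl
!-map f (x ∷ xs) {suc k} eq   = !-map f xs eq

!⇒< : ∀ {A : Set} (xs : List A) {k x} → xs ! k ≡ just x → k < length xs
!⇒< (x ∷ xs) {zero}  _  = z<s
!⇒< (x ∷ xs) {suc k} eq = s<s (!⇒< xs eq)

<⇒! : ∀ {A : Set} (xs : List A) {k} → k < length xs → ∃[ x ] xs ! k ≡ just x
<⇒! (x ∷ xs) {zero}  _       = x , refl
<⇒! (x ∷ xs) {suc k} (s<s k<) = <⇒! xs k<

∑-list : ∀ {A : Set} (h : ℕ → ℕ) (f : A → ℕ) xs s → (∀ {o x} → xs ! o ≡ just x → h (s + o) ≡ f x) →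
         ∑ s (length xs) h ≡ sum (map f xs)
∑-list h f []       s eq = refl
∑-list h f (x ∷ xs) s eq = cong₂ _+_
  (trans (cong h (sym (+-identityʳ s))) (eq {0} refl))
  (∑-list h f xs (suc s) (λ {o} xs!o → trans (cong h (sym (+-suc s o))) (eq {suc o} xs!o)))

map-filter : ∀ {A : Set} {P : A → Set} {Q : ℕ → Set} (f : A → ℕ) (P? : Decidable P) (Q? : Decidable Q) →
             (∀ x → P x → Q (f x)) → (∀ x → Q (f x) → P x) →
             ∀ xs → map f (filter P? xs) ≡ filter Q? (map f xs)
map-filter f P? Q? P⇒Q Q⇒P []       = refl
map-filter f P? Q? P⇒Q Q⇒P (x ∷ xs) with P? x | Q? (f x)
... | yes _  | yes _  = cong (f x ∷_) (map-filter f P? Q? P⇒Q Q⇒P xs)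
... | yes px | no ¬qx = ⊥-elim (¬qx (P⇒Q x px))
... | no ¬px | yes qx = ⊥-elim (¬px (Q⇒P x qx))
... | no _   | no _   = map-filter f P? Q? P⇒Q Q⇒P xs

map-toℕ-allFin : ∀ n → map toℕ (allFin n) ≡ upTo n
map-toℕ-allFin zero    = refl
map-toℕ-allFin (suc n) = cong (0 ∷_) (begin
  map toℕ (tabulate {n = n} (λ i → Fin.suc i)) ≡⟨ Data.List.Properties.map-tabulate Fin.suc toℕ ⟩
  tabulate {n = n} (λ i → suc (toℕ i))         ≡⟨ sym (Data.List.Properties.map-tabulate (λ i → i) (λ i → suc (toℕ i))) ⟩
  map (λ i → suc (toℕ i)) (allFin n)           ≡⟨ Data.List.Properties.map-∘ (allFin n) ⟩
  map suc (map toℕ (allFin n))                 ≡⟨ cong (map suc) (map-toℕ-allFin n) ⟩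
  map suc (upTo n)                             ≡⟨ Data.List.Properties.map-upTo suc n ⟩
  applyUpTo suc n                              ∎)
  where open ≡-Reasoning

filter-≤-upTo : ∀ {m n} → m < n → filter (_≤? m) (upTo n) ≡ upTo (suc m)
filter-≤-upTo {m} {n} m<n = strictlySorted-≡
  (AllPairs.filter⁺ (_≤? m) (upTo-strictlySorted n)) (upTo-strictlySorted (suc m))
  (λ k∈ → ∈-upTo⁺ (s≤s (proj₂ (∈-filter⁻ (_≤? m) {xs = upTo n} k∈))))
  (λ k∈ → let k≤m = ≤-pred (∈-upTo⁻ k∈) in ∈-filter⁺ (_≤? m) (∈-upTo⁺ (≤-<-trans k≤m m<n)) k≤m)

history-≡ : ∀ (I : Input) (obs : ℕ → Observation) → (∀ v → observe I v ≡ obs (toℕ v)) →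
            ∀ v → history I v ≡ map obs (upTo (suc (toℕ v)))
history-≡ I obs observe≡ v = begin
  map (observe I) (filter (λ j → toℕ j ≤? toℕ v) (allFin n))    ≡⟨ Data.List.Properties.map-cong observe≡ _ ⟩
  map (λ j → obs (toℕ j)) (filter (λ j → toℕ j ≤? toℕ v) (allFin n))  ≡⟨ Data.List.Properties.map-∘ _ ⟩
  map obs (map toℕ (filter (λ j → toℕ j ≤? toℕ v) (allFin n)))   ≡⟨ cong (map obs) (map-filter toℕ _ (_≤? toℕ v) (λ _ p → p) (λ _ p → p) (allFin n)) ⟩
  map obs (filter (_≤? toℕ v) (map toℕ (allFin n)))              ≡⟨ cong (λ ks → map obs (filter (_≤? toℕ v) ks)) (map-toℕ-allFin n) ⟩
  map obs (filter (_≤? toℕ v) (upTo n))                          ≡⟨ cong (map obs) (filter-≤-upTo (toℕ<n v)) ⟩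
  map obs (upTo (suc (toℕ v)))                                   ∎
  where open ≡-Reasoning
        open Input I using (n)

module _ (G : Graph) {P : Fin (Graph.n G) → Set} where

  walk-start : ∀ {a b} → WalkIn G P a b → P a
  walk-start (here pa)     = pa
  walk-start (step pa _ _) = pa

  walk-++ : ∀ {a b c} → WalkIn G P a b → WalkIn G P b c → WalkIn G P a c
  walk-++ (here _)        w₂ = w₂
  walk-++ (step pa e w₁) w₂ = step pa e (walk-++ w₁ w₂)

  walk-reverse : ∀ {a b} → WalkIn G P a b → WalkIn G P b a
  walk-reverse (here pa)               = here pa
  walk-reverse (step {a} {b} pa e w) =
    walk-++ (walk-reverse w) (step (walk-start w) (trans (sym (Graph.sym G a b)) e) (here pa))

-- The tree of a parent function on ℕ, restricted to the vertices below n

module ParentTree (n : ℕ) (parent : ℕ → ℕ) (parent< : ∀ {k} → 0 < k → parent k < k) where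

  _IsParentOf_ : ℕ → ℕ → Set
  i IsParentOf k = 0 < k × parent k ≡ i

  _isParentOf?_ : ∀ i k → Dec (i IsParentOf k)
  i isParentOf? k = (1 ≤? k) ×-dec (parent k ≟ i)

  parentᵇ : ℕ → ℕ → Bool
  parentᵇ i k = does (i isParentOf? k)

  edgeᵇ : ℕ → ℕ → Bool
  edgeᵇ i k = parentᵇ i k ∨ parentᵇ k i

  parentᵇ-irrefl : ∀ i → parentᵇ i i ≡ false
  parentᵇ-irrefl i = dec-false (i isParentOf? i) (λ (0<i , pi≡i) → <-irrefl pi≡i (parent< 0<i))

  edgeᵇ⇒ : ∀ i k → edgeᵇ i k ≡ true → i IsParentOf k ⊎ k IsParentOf i
  edgeᵇ⇒ i k eq = Data.Sum.map (does-true (i isParentOf? k)) (does-true (k isParentOf? i)) (∨-≡-true _ _ eq)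

  parent⇒edgeᵇ : ∀ {i k} → i IsParentOf k → edgeᵇ i k ≡ true
  parent⇒edgeᵇ i∣k rewrite dec-true (_ isParentOf? _) i∣k = refl

  child⇒edgeᵇ : ∀ {i k} → k IsParentOf i → edgeᵇ i k ≡ true
  child⇒edgeᵇ {i} {k} k∣i rewrite dec-true (_ isParentOf? _) k∣i = Data.Bool.Properties.∨-zeroʳ (parentᵇ i k)

  graph : Graph
  graph = record
    { n      = n
    ; adj    = λ i j → edgeᵇ (toℕ i) (toℕ j)
    ; sym    = λ i j → Data.Bool.Properties.∨-comm (parentᵇ (toℕ i) (toℕ j)) _
    ; irrefl = λ i → cong₂ _∨_ (parentᵇ-irrefl (toℕ i)) (parentᵇ-irrefl (toℕ i))
    }

  Adj′ : Fin n → Fin n → Set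
  Adj′ = Adj graph

  Adj′-sym : ∀ {u v} → Adj′ u v → Adj′ v u
  Adj′-sym {u} {v} e = trans (Graph.sym graph v u) e

  smaller-neighbour-is-parent : ∀ u x → Adj′ u x → toℕ u < toℕ x → parent (toℕ x) ≡ toℕ u
  smaller-neighbour-is-parent u x e u<x with edgeᵇ⇒ (toℕ u) (toℕ x) e
  ... | inj₁ (_ , px≡u)   = px≡u
  ... | inj₂ (0<u , pu≡x) = ⊥-elim (<-asym u<x (subst (_< toℕ u) pu≡x (parent< 0<u)))

  smaller-neighbours-equal : ∀ {u x w} → Adj′ u x → Adj′ x w → toℕ u < toℕ x → toℕ w < toℕ x → u ≡ w
  smaller-neighbours-equal {u} {x} {w} ux xw u<x w<x = toℕ-injective (begin
    toℕ u          ≡⟨ sym (smaller-neighbour-is-parent u x ux u<x) ⟩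
    parent (toℕ x) ≡⟨ smaller-neighbour-is-parent w x (Adj′-sym {x} {w} xw) w<x ⟩
    toℕ w          ∎)
    where open ≡-Reasoning

  parentFin : (a : Fin n) → 0 < toℕ a → Fin n
  parentFin a 0<a = fromℕ< (<-trans (parent< 0<a) (toℕ<n a))

  toℕ-parentFin : ∀ a 0<a → toℕ (parentFin a 0<a) ≡ parent (toℕ a)
  toℕ-parentFin a 0<a = toℕ-fromℕ< _

  Adj′-parentFin : ∀ a 0<a → Adj′ a (parentFin a 0<a)
  Adj′-parentFin a 0<a = child⇒edgeᵇ (0<a , sym (toℕ-parentFin a 0<a))

  module _ {P : Fin n → Set} (P-parent : ∀ a 0<a → P a → P (parentFin a 0<a)) where

    walk-to-root : ∀ a → Acc _<_ (toℕ a) → P a → ∃[ r ] toℕ r ≡ 0 × WalkIn graph P a r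
    walk-to-root a (acc rs) pa with toℕ a in eq
    ... | zero  = a , eq , here pa
    ... | suc k =
      let 0<a    = subst (0 <_) (sym eq) z<s
          pa<a   = subst (_< toℕ a) (sym (toℕ-parentFin a 0<a)) (parent< 0<a)
          r , r≡0 , w = walk-to-root (parentFin a 0<a) (rs (subst (toℕ (parentFin a 0<a) <_) eq pa<a)) (P-parent a 0<a pa)
      in r , r≡0 , step pa (Adj′-parentFin a 0<a) w

    connected-via-root : ConnectedOn graph P
    connected-via-root a b pa pb =
      let ra , ra≡0 , wa = walk-to-root a (<-wellFounded (toℕ a)) pa
          rb , rb≡0 , wb = walk-to-root b (<-wellFounded (toℕ b)) pb
          ra≡rb = toℕ-injective (trans ra≡0 (sym rb≡0))
      in walk-++ graph wa (subst (λ r → WalkIn graph P r b) (sym ra≡rb) (walk-reverse graph wb))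

  prefix-connected : ∀ i → ConnectedOn graph (λ v → toℕ v < i)
  prefix-connected i = connected-via-root
    (λ a 0<a a<i → subst (_< i) (sym (toℕ-parentFin a 0<a)) (<-trans (parent< 0<a) a<i))

  connected : Connected graph
  connected a b = connected-via-root (λ a 0<a _ → parentFin a 0<a) a b a b

  input : Input
  input = record
    { graph            = graph
    ; label            = toℕ
    ; label-inj        = toℕ-injective
    ; prefix-connected = prefix-connected
    }

  closedᵇ : ℕ → ℕ → Bool
  closedᵇ i k = does (i ≟ k) ∨ edgeᵇ i k

  closed? : ∀ i → Decidable (λ k → closedᵇ i k ≡ true)
  closed? i k = closedᵇ i k Data.Bool.Properties.≟ true

  closedᵇ⇒ : ∀ i k → closedᵇ i k ≡ true → i ≡ k ⊎ i IsParentOf k ⊎ k IsParentOf i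
  closedᵇ⇒ i k eq = Data.Sum.map (does-true (i ≟ k)) (edgeᵇ⇒ i k) (∨-≡-true _ _ eq)

  ⇒closedᵇ : ∀ {i k} → i ≡ k ⊎ i IsParentOf k ⊎ k IsParentOf i → closedᵇ i k ≡ true
  ⇒closedᵇ {i} {k} (inj₁ i≡k) = cong (_∨ edgeᵇ i k) (dec-true (i ≟ k) i≡k)
  ⇒closedᵇ {i} {k} (inj₂ (inj₁ i∣k)) = trans (cong (does (i ≟ k) ∨_) (parent⇒edgeᵇ i∣k)) (Data.Bool.Properties.∨-zeroʳ _)
  ⇒closedᵇ {i} {k} (inj₂ (inj₂ k∣i)) = trans (cong (does (i ≟ k) ∨_) (child⇒edgeᵇ k∣i)) (Data.Bool.Properties.∨-zeroʳ _)

  map-toℕ-closedNbrs : ∀ v → map toℕ (closedNbrs input v) ≡ filter (closed? (toℕ v)) (upTo n)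
  map-toℕ-closedNbrs v = begin
    map toℕ (closedNbrs input v)                     ≡⟨ map-filter toℕ _ (closed? (toℕ v)) (λ j → subst (Closed j) (≟-toℕ j))
                                                                                           (λ j → subst (Closed j) (sym (≟-toℕ j))) (allFin n) ⟩
    filter (closed? (toℕ v)) (map toℕ (allFin n))    ≡⟨ cong (filter (closed? (toℕ v))) (map-toℕ-allFin n) ⟩
    filter (closed? (toℕ v)) (upTo n)                ∎
    where open ≡-Reasoning
          Closed : Fin n → Bool → Set
          Closed j b = (b ∨ edgeᵇ (toℕ v) (toℕ j)) ≡ true
          ≟-toℕ : ∀ j → does (v Fin.≟ j) ≡ does (toℕ v ≟ toℕ j)
          ≟-toℕ j = does-⇔ (mk⇔ (cong toℕ) toℕ-injective) (v Fin.≟ j) (toℕ v ≟ toℕ j)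

  ≢⇒<⊎> : ∀ {u v : Fin n} → u ≢ v → u <ᶠ v ⊎ v <ᶠ u
  ≢⇒<⊎> {u} {v} u≢v with <-cmp (toℕ u) (toℕ v)
  ... | tri< u<v _ _ = inj₁ u<v
  ... | tri≈ _ u≡v _ = ⊥-elim (u≢v (toℕ-injective u≡v))
  ... | tri> _ _ v<u = inj₂ v<u

  lastOf : Fin n → List (Fin n) → Fin n
  lastOf y []       = y
  lastOf y (z ∷ zs) = lastOf z zs

  beforeLast : Fin n → Fin n → List (Fin n) → Fin n
  beforeLast y₀ y₁ []        = y₀
  beforeLast y₀ y₁ (y₂ ∷ ys) = beforeLast y₁ y₂ ys

  lastOf-∈ : ∀ y ys → lastOf y ys ∈ y ∷ ys
  lastOf-∈ y []       = here refl
  lastOf-∈ y (z ∷ zs) = there (lastOf-∈ z zs)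

  beforeLast-∈ : ∀ y₀ y₁ y₂ ys → beforeLast y₀ y₁ (y₂ ∷ ys) ∈ y₁ ∷ y₂ ∷ ys
  beforeLast-∈ y₀ y₁ y₂ []        = here refl
  beforeLast-∈ y₀ y₁ y₂ (y₃ ∷ ys) = there (beforeLast-∈ y₁ y₂ y₃ ys)

  Linked-last : ∀ {R : Fin n → Fin n → Set} {y₀ y₁} ys → Linked R (y₀ ∷ y₁ ∷ ys) → R (beforeLast y₀ y₁ ys) (lastOf y₁ ys)
  Linked-last []       (r ∷ _)    = r
  Linked-last (_ ∷ ys) (_ ∷ rest) = Linked-last ys rest

  Linked-<-last : ∀ {y₀ y₁} ys → Linked _<ᶠ_ (y₀ ∷ y₁ ∷ ys) → y₀ <ᶠ lastOf y₁ ys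
  Linked-<-last []       (r ∷ _)    = r
  Linked-<-last (_ ∷ ys) (r ∷ rest) = <-trans r (Linked-<-last ys rest)

  -- A path that steps up can never step down again: a step down would give a vertex two smaller neighbours.
  rising-path : ∀ {y₀ y₁} ys → Linked Adj′ (y₀ ∷ y₁ ∷ ys) → AllPairs _≢_ (y₀ ∷ y₁ ∷ ys) →
                y₀ <ᶠ y₁ → Linked _<ᶠ_ (y₀ ∷ y₁ ∷ ys)
  rising-path []        _ _ y₀<y₁ = y₀<y₁ ∷ [-]
  rising-path (y₂ ∷ ys) (y₀~y₁ ∷ path) ((_ ∷ y₀≢y₂ ∷ _) ∷ distinct@((y₁≢y₂ ∷ _) ∷ _)) y₀<y₁
    with ≢⇒<⊎> y₁≢y₂
  ... | inj₁ y₁<y₂ = y₀<y₁ ∷ rising-path ys path distinct y₁<y₂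
  ... | inj₂ y₂<y₁ = ⊥-elim (y₀≢y₂ (smaller-neighbours-equal y₀~y₁ (Linked.head path) y₀<y₁ y₂<y₁))

  falling-or-rising-at-end : ∀ {y₀ y₁} ys → Linked Adj′ (y₀ ∷ y₁ ∷ ys) → AllPairs _≢_ (y₀ ∷ y₁ ∷ ys) →
                             lastOf y₁ ys <ᶠ y₀ ⊎ beforeLast y₀ y₁ ys <ᶠ lastOf y₁ ys
  falling-or-rising-at-end [] path ((y₀≢y₁ ∷ []) ∷ _) = Data.Sum.swap (≢⇒<⊎> y₀≢y₁)
  falling-or-rising-at-end (y₂ ∷ ys) path@(_ ∷ path′) distinct@((y₀≢y₁ ∷ _) ∷ distinct′)
    with falling-or-rising-at-end ys path′ distinct′ | ≢⇒<⊎> y₀≢y₁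
  ... | inj₂ rising-end | _          = inj₂ rising-end
  ... | inj₁ l<y₁       | inj₂ y₁<y₀ = inj₁ (<-trans l<y₁ y₁<y₀)
  ... | inj₁ _          | inj₁ y₀<y₁ = inj₂ (Linked-last (y₂ ∷ ys) (rising-path (y₂ ∷ ys) path distinct y₀<y₁))

  -- IsCycle states its closing edge through a local function; this recovers the type of that component.
  ClosingEdge : Fin n → List (Fin n) → Set
  ClosingEdge x xs = fourth (λ (c : IsCycle graph (x ∷ xs)) → c)
    where fourth : ∀ {A B C D : Set} → (A × B × C × D → A × B × C × D) → Set
          fourth {D = D} _ = D

  ClosingEdge⇒Adj′ : ∀ x y ys → ClosingEdge x (y ∷ ys) → Adj′ (lastOf y ys) x
  ClosingEdge⇒Adj′ x y []       e = e
  ClosingEdge⇒Adj′ x y (z ∷ zs) e = ClosingEdge⇒Adj′ x z zs e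

  -- A largest vertex of a cycle would have two smaller neighbours.
  acyclic : ∀ xs → ¬ IsCycle graph xs
  acyclic (x ∷ [])         (s≤s () , _)
  acyclic (x ∷ a ∷ [])     (s≤s (s≤s ()) , _)
  acyclic (x ∷ a ∷ b ∷ ys) (_ , distinct@(x≢rest ∷ (a≢rest ∷ _)) , path , closing) =
    Data.Sum.[ x<l⇒⊥ , l<x⇒⊥ ]′ (≢⇒<⊎> (All.lookup x≢rest (lastOf-∈ a (b ∷ ys))))
    where
    l = lastOf a (b ∷ ys)

    l~x : Adj′ l x
    l~x = ClosingEdge⇒Adj′ x a (b ∷ ys) closing

    x<l⇒⊥ : x <ᶠ l → ⊥
    x<l⇒⊥ x<l with falling-or-rising-at-end (b ∷ ys) path distinct
    ... | inj₁ l<x = <-asym x<l l<x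
    ... | inj₂ p<l = All.lookup x≢rest (beforeLast-∈ x a b ys)
                       (sym (smaller-neighbours-equal (Linked-last (b ∷ ys) path) l~x p<l x<l))

    l<x⇒⊥ : l <ᶠ x → ⊥
    l<x⇒⊥ l<x with ≢⇒<⊎> (All.lookup x≢rest (here refl))
    ... | inj₁ x<a = <-asym l<x (Linked-<-last (b ∷ ys) (rising-path (b ∷ ys) path distinct x<a))
    ... | inj₂ a<x = All.lookup a≢rest (lastOf-∈ b ys)
                       (sym (smaller-neighbours-equal l~x (Linked.head path) l<x a<x))

  isTree : IsTree graph
  isTree = connected , acyclic

sum-map-replicate : ∀ {A : Set} (f : A → ℕ) k x → sum (map f (replicate k x)) ≡ k * f x
sum-map-replicate f zero    x = refl
sum-map-replicate f (suc k) x = cong (f x +_) (sum-map-replicate f k x)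

-- The adversary

data Kind : Set where
  hub leaf fork query : Kind

module Adversary (K B : ℕ) where

  accepts : Kind → Bool → ℕ → Bool
  accepts query b a = b ∧ (a <ᵇ B)
  accepts _     _ _ = false

  children : Kind → Bool → List Kind
  children hub   _     = leaf ∷ replicate K query
  children leaf  _     = []
  children fork  _     = leaf ∷ leaf ∷ []
  children query true  = fork ∷ query ∷ []
  children query false = leaf ∷ leaf ∷ []

  degree : Kind → ℕ
  degree hub   = suc K
  degree leaf  = 0
  degree fork  = 2
  degree query = 2

  -- The number of children does not depend on the answer, so neither does the revealed neighbourhood.
  length-children : ∀ κ g → length (children κ g) ≡ degree κ
  length-children hub   _     = cong suc (Data.List.Properties.length-replicate K)
  length-children leaf  _     = refl
  length-children fork  _     = refl
  length-children query true  = refl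
  length-children query false = refl

  -- A vertex waiting to be revealed: its kind and its parent.
  Entry : Set
  Entry = Kind × ℕ

  record State : Set where
    constructor mkState
    field
      queue     : List Entry
      accepted  : ℕ
      allocated : ℕ
  open State public

  initial : State
  initial = mkState ((hub , 0) ∷ []) 0 1

  advance : ℕ → Bool → State → State
  advance i b (mkState []              a m) = mkState [] a m
  advance i b (mkState ((κ , _) ∷ es) a m) =
    mkState (es ++ map (_, i) (children κ (accepts κ b a))) (a + 𝟙 (accepts κ b a)) (m + degree κ)

  -- The entry (leaf , 0) for an exhausted queue is a junk value.
  front : List Entry → Entry
  front []      = leaf , 0
  front (e ∷ _) = e

  head : State → Entry
  head s = front (queue s)

  NonEmpty : State → Set
  NonEmpty s = ∃[ κ ] ∃[ p ] ∃[ es ] queue s ≡ (κ , p) ∷ es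

  empty-or-nonEmpty : ∀ s → queue s ≡ [] ⊎ NonEmpty s
  empty-or-nonEmpty (mkState []             _ _) = inj₁ refl
  empty-or-nonEmpty (mkState ((κ , p) ∷ es) _ _) = inj₂ (κ , p , es , refl)

  nonEmpty-≢[] : ∀ s → NonEmpty s → queue s ≢ []
  nonEmpty-≢[] s (_ , _ , _ , eq) q≡[] with () ← trans (sym eq) q≡[]

  advance-[] : ∀ i b s → queue s ≡ [] → advance i b s ≡ s
  advance-[] i b (mkState [] a m) refl = refl

  accepted-advance : ∀ i b s → accepted (advance i b s) ≡ accepted s + 𝟙 (accepts (proj₁ (head s)) b (accepted s))
  accepted-advance i b (mkState []      a m) = sym (+-identityʳ a)
  accepted-advance i b (mkState (_ ∷ _) a m) = refl

  allocated-advance : ∀ i b s → allocated s ≤ allocated (advance i b s)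
  allocated-advance i b (mkState []            a m) = ≤-refl
  allocated-advance i b (mkState ((κ , _) ∷ _) a m) = m≤m+n m (degree κ)

  length-advance : ∀ i b s {κ p es} → queue s ≡ (κ , p) ∷ es → length (queue (advance i b s)) ≡ length es + degree κ
  length-advance i b (mkState _ a m) {κ} {es = es} refl = begin
    length (es ++ map (_, i) (children κ g))       ≡⟨ Data.List.Properties.length-++ es ⟩
    length es + length (map (_, i) (children κ g)) ≡⟨ cong (length es +_) (Data.List.Properties.length-map (_, i) (children κ g)) ⟩
    length es + length (children κ g)              ≡⟨ cong (length es +_) (length-children κ g) ⟩
    length es + degree κ                           ∎
    where open ≡-Reasoning
          g = accepts κ b a

  Consistent : ℕ → State → Set
  Consistent i s = allocated s ≡ i + length (queue s) ⊎ (queue s ≡ [] × allocated s ≤ i)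

  consistent-advance : ∀ i b s → Consistent i s → Consistent (suc i) (advance i b s)
  consistent-advance i b (mkState [] a m) (inj₁ m≡i+0)   = inj₂ (refl , m≤n⇒m≤1+n (≤-reflexive (trans m≡i+0 (+-identityʳ i))))
  consistent-advance i b (mkState [] a m) (inj₂ (_ , m≤i)) = inj₂ (refl , m≤n⇒m≤1+n m≤i)
  consistent-advance i b s@(mkState ((κ , _) ∷ es) a m) (inj₁ m≡i+1+es) = inj₁ (begin
    m + degree κ                        ≡⟨ cong (_+ degree κ) m≡i+1+es ⟩
    i + suc (length es) + degree κ      ≡⟨ cong (_+ degree κ) (+-suc i (length es)) ⟩
    suc i + length es + degree κ        ≡⟨ +-assoc (suc i) (length es) (degree κ) ⟩
    suc i + (length es + degree κ)      ≡⟨ cong (suc i +_) (length-advance i b s refl) ⟨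
    suc i + length (queue (advance i b s)) ∎)
    where open ≡-Reasoning

  consistent-[] : ∀ i s → Consistent i s → queue s ≡ [] → allocated s ≤ i
  consistent-[] i s (inj₁ m≡i+l) q≡[] = ≤-reflexive (trans m≡i+l (trans (cong (λ q → i + length q) q≡[]) (+-identityʳ i)))
  consistent-[] i s (inj₂ (_ , m≤i)) _   = m≤i

  front-! : ∀ es {e} → es ! 0 ≡ just e → front es ≡ e
  front-! (e ∷ _) refl = refl

  !-advance : ∀ i b s {t e} → queue s ! suc t ≡ just e → queue (advance i b s) ! t ≡ just e
  !-advance i b (mkState (_ ∷ es) a m) eq = !-++ˡ es _ eq

  children-!-advance : ∀ i b s {κ p es o κ′} → queue s ≡ (κ , p) ∷ es → children κ (accepts κ b (accepted s)) ! o ≡ just κ′ →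
                       queue (advance i b s) ! (length es + o) ≡ just (κ′ , i)
  children-!-advance i b (mkState _ a m) {κ} {es = es} {o} refl eq =
    trans (!-++ʳ es _ o) (!-map (_, i) (children κ (accepts κ b a)) eq)

  weight : Kind → ℕ
  weight hub   = 2 + 3 * K
  weight leaf  = 1
  weight fork  = 3
  weight query = 3

  -- Accepting a query adds weight 3 to the queue but uses up a unit of budget, which is worth 4.
  potential : State → ℕ
  potential s = sum (map (weight ∘ proj₁) (queue s)) + 4 * (B ∸ accepted s)

  accepts⇒<B : ∀ b a → accepts query b a ≡ true → a < B
  accepts⇒<B true a accept = <ᵇ⇒< a B (Equivalence.from Data.Bool.Properties.T-≡ accept)

  children-potential : ∀ κ b a → let g = accepts κ b a in
    sum (map weight (children κ g)) + 4 * (B ∸ (a + 𝟙 g)) < weight κ + 4 * (B ∸ a)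
  children-potential hub   b a rewrite +-identityʳ a | sum-map-replicate weight K query | *-comm K 3 = n<1+n _
  children-potential leaf  b a rewrite +-identityʳ a = n<1+n _
  children-potential fork  b a rewrite +-identityʳ a = n<1+n _
  children-potential query b a with b ∧ (a <ᵇ B) in accept
  ... | false rewrite +-identityʳ a = n<1+n _
  ... | true  = begin-strict
    3 + 3 + 4 * (B ∸ (a + 1))  ≡⟨ cong (λ c → 6 + 4 * (B ∸ c)) (+-comm a 1) ⟩
    6 + 4 * (B ∸ suc a)        <⟨ n<1+n _ ⟩
    7 + 4 * (B ∸ suc a)        ≡⟨ cong (3 +_) (sym (*-suc 4 (B ∸ suc a))) ⟩
    3 + 4 * suc (B ∸ suc a)    ≡⟨ cong (λ c → 3 + 4 * c) (sym (+-∸-assoc 1 (accepts⇒<B b a accept))) ⟩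
    3 + 4 * (B ∸ a)            ∎
    where open ≤-Reasoning

  potential-advance : ∀ i b s → NonEmpty s → potential (advance i b s) < potential s
  potential-advance i b (mkState ((κ , p) ∷ es) a m) _ = begin-strict
    sum (map w (es ++ map (_, i) ch)) + X       ≡⟨ cong (_+ X) (weight-queue es ch) ⟩
    W + sum (map weight ch) + X                 ≡⟨ +-assoc W _ X ⟩
    W + (sum (map weight ch) + X)               <⟨ +-monoʳ-< W (children-potential κ b a) ⟩
    W + (weight κ + 4 * (B ∸ a))                ≡⟨ sym (+-assoc W _ _) ⟩
    W + weight κ + 4 * (B ∸ a)                  ≡⟨ cong (_+ 4 * (B ∸ a)) (+-comm W (weight κ)) ⟩
    weight κ + W + 4 * (B ∸ a)                  ∎
    where
    open ≤-Reasoning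
    w  = weight ∘ proj₁
    ch = children κ (accepts κ b a)
    W  = sum (map w es)
    X  = 4 * (B ∸ (a + 𝟙 (accepts κ b a)))
    weight-queue : ∀ es ks → sum (map w (es ++ map (_, i) ks)) ≡ sum (map w es) + sum (map weight ks)
    weight-queue es ks = begin-equality
      sum (map w (es ++ map (_, i) ks))         ≡⟨ cong sum (Data.List.Properties.map-++ w es _) ⟩
      sum (map w es ++ map w (map (_, i) ks))   ≡⟨ sum-++ (map w es) _ ⟩
      sum (map w es) + sum (map w (map (_, i) ks)) ≡⟨ cong (λ xs → sum (map w es) + sum xs) (sym (Data.List.Properties.map-∘ ks)) ⟩
      sum (map w es) + sum (map weight ks)      ∎

  potential-pos : ∀ s → NonEmpty s → 0 < potential s
  potential-pos (mkState ((κ , _) ∷ es) _ _) _ = <-≤-trans (weight-pos κ) (≤-trans (m≤m+n (weight κ) _) (m≤m+n _ _))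
    where weight-pos : ∀ κ → 0 < weight κ
          weight-pos hub   = z<s
          weight-pos leaf  = z<s
          weight-pos fork  = z<s
          weight-pos query = z<s

  run : (ℕ → Bool) → ℕ → State
  run δ zero    = initial
  run δ (suc i) = advance i (δ i) (run δ i)

  run-local : ∀ δ δ′ i → (∀ {k} → k < i → δ k ≡ δ′ k) → run δ i ≡ run δ′ i
  run-local δ δ′ zero    agree = refl
  run-local δ δ′ (suc i) agree = cong₂ (advance i) (agree ≤-refl) (run-local δ δ′ i (λ k<i → agree (m<n⇒m<1+n k<i)))

  -- Vertex i sees its parent (if i > 0), itself, and its children, numbered consecutively from i + length queue.
  neighbours : ℕ → State → List ℕ
  neighbours i s = parentPart i ++ i ∷ applyUpTo (i + length (queue s) +_) (degree (proj₁ (head s)))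
    where parentPart : ℕ → List ℕ
          parentPart zero    = []
          parentPart (suc _) = proj₂ (head s) ∷ []

  transcript : (ℕ → Bool) → ℕ → List Observation
  transcript δ i = map (λ k → k , sort (neighbours k (run δ k))) (upTo (suc i))

  transcript-local : ∀ δ δ′ i → (∀ {k} → k < i → δ k ≡ δ′ k) → transcript δ i ≡ transcript δ′ i
  transcript-local δ δ′ i agree = Data.List.Properties.map-cong-local
    (All.applyUpTo⁺₁ (λ k → k) (suc i) (λ {k} k≤i →
      cong (λ s → k , sort (neighbours k s)) (run-local δ δ′ k (λ j<k → agree (<-≤-trans j<k (≤-pred k≤i))))))

  module Run (δ : ℕ → Bool) where

    state : ℕ → State
    state = run δ

    kind : ℕ → Kind
    kind i = proj₁ (head (state i))

    parent : ℕ → ℕ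
    parent i = proj₂ (head (state i))

    grows : ℕ → Bool
    grows i = accepts (kind i) (δ i) (accepted (state i))

    firstChild : ℕ → ℕ
    firstChild i = i + length (queue (state i))

    deg : ℕ → ℕ
    deg i = degree (kind i)

    observation : ℕ → Observation
    observation i = i , sort (neighbours i (state i))


    frozen : ∀ i t → queue (state i) ≡ [] → state (i + t) ≡ state i
    frozen i zero    q≡[] = cong state (+-identityʳ i)
    frozen i (suc t) q≡[] = begin
      state (i + suc t)                       ≡⟨ cong state (+-suc i t) ⟩
      advance (i + t) _ (state (i + t))       ≡⟨ advance-[] (i + t) _ _ (trans (cong queue (frozen i t q≡[])) q≡[]) ⟩
      state (i + t)                           ≡⟨ frozen i t q≡[] ⟩
      state i                                 ∎
      where open ≡-Reasoning

    consistent : ∀ i → Consistent i (state i)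
    consistent zero    = inj₁ refl
    consistent (suc i) = consistent-advance i (δ i) (state i) (consistent i)

    allocated-mono : ∀ {i j} → i ≤ j → allocated (state i) ≤ allocated (state j)
    allocated-mono {i} {j} i≤j with m≤n⇒∃[o]m+o≡n i≤j
    ... | t , refl = go t
      where go : ∀ t → allocated (state i) ≤ allocated (state (i + t))
            go zero    = ≤-reflexive (cong (allocated ∘ state) (sym (+-identityʳ i)))
            go (suc t) = ≤-trans (go t) (≤-trans (allocated-advance (i + t) (δ (i + t)) (state (i + t)))
                                               (≤-reflexive (cong (allocated ∘ state) (sym (+-suc i t)))))

    progress : ∀ i → queue (state i) ≡ [] ⊎ potential (state i) + i ≤ potential initial
    progress zero    = inj₂ (≤-reflexive (+-identityʳ _))
    progress (suc i) with progress i | empty-or-nonEmpty (state i)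
    ... | inj₁ q≡[] | _ = inj₁ (trans (cong queue (advance-[] i (δ i) _ q≡[])) q≡[])
    ... | inj₂ _    | inj₁ q≡[] = inj₁ (trans (cong queue (advance-[] i (δ i) _ q≡[])) q≡[])
    ... | inj₂ bound | inj₂ ne = inj₂ (begin
      potential (state (suc i)) + suc i  ≡⟨ +-suc _ i ⟩
      suc (potential (state (suc i))) + i ≤⟨ +-monoˡ-≤ i (potential-advance i (δ i) (state i) ne) ⟩
      potential (state i) + i             ≤⟨ bound ⟩
      potential initial                   ∎)
      where open ≤-Reasoning

    N : ℕ
    N = potential initial

    queue-N : queue (state N) ≡ []
    queue-N with progress N | empty-or-nonEmpty (state N)
    ... | inj₁ q≡[] | _         = q≡[]
    ... | inj₂ _    | inj₁ q≡[] = q≡[]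
    ... | inj₂ bound | inj₂ ne  = ⊥-elim (<-irrefl refl (<-≤-trans (+-monoˡ-< N (potential-pos (state N) ne)) bound))

    n : ℕ
    n = allocated (state N)

    n≤N : n ≤ N
    n≤N = consistent-[] N (state N) (consistent N) queue-N

    active : ∀ {i} → i < n → NonEmpty (state i)
    active {i} i<n with empty-or-nonEmpty (state i)
    ... | inj₂ ne   = ne
    ... | inj₁ q≡[] = ⊥-elim (<-irrefl refl (<-≤-trans i<n (begin
      allocated (state N)              ≡⟨ cong (allocated ∘ state) (sym (m+[n∸m]≡n i≤N)) ⟩
      allocated (state (i + (N ∸ i)))  ≡⟨ cong allocated (frozen i (N ∸ i) q≡[]) ⟩
      allocated (state i)              ≤⟨ consistent-[] i (state i) (consistent i) q≡[] ⟩
      i                                ∎)))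
      where open ≤-Reasoning
            i≤N = ≤-trans (<⇒≤ i<n) n≤N

    queue-n : queue (state n) ≡ []
    queue-n with consistent n
    ... | inj₂ (q≡[] , _) = q≡[]
    ... | inj₁ m≡n+l      = length≡0⇒≡[] (n+l≤n⇒l≡0 (begin
      n + length (queue (state n))   ≡⟨ sym m≡n+l ⟩
      allocated (state n)            ≤⟨ allocated-mono n≤N ⟩
      n                              ∎))
      where open ≤-Reasoning
            length≡0⇒≡[] : ∀ {xs : List Entry} → length xs ≡ 0 → xs ≡ []
            length≡0⇒≡[] {[]} _ = refl
            n+l≤n⇒l≡0 : ∀ {l} → n + l ≤ n → l ≡ 0
            n+l≤n⇒l≡0 {l} le = n≤0⇒n≡0 (+-cancelˡ-≤ n l 0 (≤-trans le (≤-reflexive (sym (+-identityʳ n)))))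

    inactive : ∀ {k} → n ≤ k → queue (state k) ≡ []
    inactive {k} n≤k = begin
      queue (state k)                ≡⟨ cong (queue ∘ state) (sym (m+[n∸m]≡n n≤k)) ⟩
      queue (state (n + (k ∸ n)))    ≡⟨ cong queue (frozen n (k ∸ n) queue-n) ⟩
      queue (state n)                ≡⟨ queue-n ⟩
      []                             ∎
      where open ≡-Reasoning

    kind-front : ∀ j {κ p es} → queue (state j) ≡ (κ , p) ∷ es → kind j ≡ κ
    kind-front j eq = cong (proj₁ ∘ front) eq

    firstChild-suc : ∀ {j} → j < n → firstChild (suc j) ≡ firstChild j + deg j
    firstChild-suc {j} j<n with active j<n
    ... | κ , p , es , eq = begin
      suc j + length (queue (state (suc j)))   ≡⟨ cong (suc j +_) (length-advance j (δ j) (state j) eq) ⟩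
      suc j + (length es + degree κ)           ≡⟨ sym (+-assoc (suc j) (length es) (degree κ)) ⟩
      suc j + length es + degree κ             ≡⟨ cong₂ _+_ (sym (+-suc j (length es))) (cong degree (sym (kind-front j eq))) ⟩
      j + suc (length es) + deg j              ≡⟨ cong (λ q → j + length q + deg j) (sym eq) ⟩
      firstChild j + deg j                     ∎
      where open ≡-Reasoning

    j<firstChild : ∀ {j} → j < n → j < firstChild j
    j<firstChild {j} j<n with active j<n
    ... | _ , _ , es , eq = subst (λ q → j < j + length q) (sym eq) (m<m+n j z<s)

    firstChild≤n : ∀ {j} → j ≤ n → firstChild j ≤ n
    firstChild≤n {j} j≤n with m≤n⇒m<n∨m≡n j≤n
    ... | inj₂ refl = ≤-reflexive (trans (cong (λ q → n + length q) queue-n) (+-identityʳ n))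
    ... | inj₁ j<n with consistent j
    ...   | inj₁ m≡ = subst (_≤ n) m≡ (allocated-mono (≤-trans (<⇒≤ j<n) n≤N))
    ...   | inj₂ (q≡[] , _) = ⊥-elim (nonEmpty-≢[] (state j) (active j<n) q≡[])

    firstChild+deg≤n : ∀ {j} → j < n → firstChild j + deg j ≤ n
    firstChild+deg≤n j<n = subst (_≤ n) (firstChild-suc j<n) (firstChild≤n j<n)

    head-later : ∀ t i {e} → queue (state i) ! t ≡ just e → head (state (i + t)) ≡ e
    head-later zero    i eq = trans (cong (head ∘ state) (+-identityʳ i)) (front-! (queue (state i)) eq)
    head-later (suc t) i eq = trans (cong (head ∘ state) (+-suc i t)) (head-later t (suc i) (!-advance i (δ i) (state i) eq))

    childAt : ∀ {j o κ} → j < n → children (kind j) (grows j) ! o ≡ just κ →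
              kind (firstChild j + o) ≡ κ × parent (firstChild j + o) ≡ j
    childAt {j} {o} {κ} j<n child with active j<n
    ... | κ₀ , p , es , eq = cong proj₁ head≡ , cong proj₂ head≡
      where
      index : suc j + (length es + o) ≡ firstChild j + o
      index = begin
        suc j + (length es + o)  ≡⟨ sym (+-assoc (suc j) (length es) o) ⟩
        suc j + length es + o    ≡⟨ cong (_+ o) (sym (+-suc j (length es))) ⟩
        j + suc (length es) + o  ≡⟨ cong (λ q → j + length q + o) (sym eq) ⟩
        firstChild j + o         ∎
        where open ≡-Reasoning
      child₀ : children κ₀ (accepts κ₀ (δ j) (accepted (state j))) ! o ≡ just κ
      child₀ = subst (λ κ₁ → children κ₁ (accepts κ₁ (δ j) (accepted (state j))) ! o ≡ just κ) (kind-front j eq) child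
      head≡ : head (state (firstChild j + o)) ≡ (κ , j)
      head≡ = trans (cong (head ∘ state) (sym index)) (head-later (length es + o) (suc j)
        (children-!-advance j (δ j) (state j) eq child₀))

    child-bounds : ∀ {j o κ} → j < n → children (kind j) (grows j) ! o ≡ just κ → 0 < firstChild j + o × firstChild j + o < n
    child-bounds {j} {o} j<n child =
      let o<deg = subst (o <_) (length-children (kind j) (grows j)) (!⇒< (children (kind j) (grows j)) child)
      in <-≤-trans z<s (≤-trans (j<firstChild j<n) (m≤m+n _ o)) ,
         <-≤-trans (+-monoʳ-< (firstChild j) o<deg) (firstChild+deg≤n j<n)

    owner : ∀ {k} → 0 < k → ∀ d → k < firstChild d → ∃[ j ] j < d × firstChild j ≤ k × k < firstChild (suc j)
    owner {k} 0<k zero    k<1 = ⊥-elim (<-irrefl refl (<-≤-trans 0<k (≤-pred k<1)))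
    owner {k} 0<k (suc d) k<fc with firstChild d ≤? k
    ... | yes fc≤k = d , ≤-refl , fc≤k , k<fc
    ... | no  fc≰k = let j , j<d , fc≤k , k<fc′ = owner 0<k d (≰⇒> fc≰k) in j , m<n⇒m<1+n j<d , fc≤k , k<fc′

    placement : ∀ {k} → 0 < k → k < n →
      ∃[ j ] ∃[ o ] j < k × k ≡ firstChild j + o × o < deg j × parent k ≡ j × children (kind j) (grows j) ! o ≡ just (kind k)
    placement {k} 0<k k<n =
      let j , j<k , fc≤k , k<fc′ = owner 0<k k (j<firstChild k<n)
          j<n    = <-trans j<k k<n
          o      = k ∸ firstChild j
          k≡fc+o = sym (m+[n∸m]≡n fc≤k)
          o<deg  = +-cancelˡ-< (firstChild j) o (deg j) (subst₂ _<_ k≡fc+o (firstChild-suc j<n) k<fc′)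
          κ , child = <⇒! (children (kind j) (grows j)) (subst (o <_) (sym (length-children (kind j) (grows j))) o<deg)
          kind≡ , parent≡ = childAt j<n child
      in j , o , j<k , k≡fc+o , o<deg , trans (cong parent k≡fc+o) parent≡ ,
         trans child (cong just (sym (trans (cong kind k≡fc+o) kind≡)))

    parent-not-leaf : ∀ {u} → 0 < u → u < n → kind (parent u) ≢ leaf
    parent-not-leaf 0<u u<n parent-leaf =
      let j , o , _ , _ , o<deg , pu≡j , _ = placement 0<u u<n
      in n≮0 (subst (o <_) (cong degree parent-leaf) (subst (λ j → o < deg j) (sym pu≡j) o<deg))

    parent< : ∀ {k} → 0 < k → parent k < k
    parent< {k} 0<k with k <? n
    ... | yes k<n = let j , _ , j<k , _ , _ , parent≡ , _ = placement 0<k k<n in subst (_< k) (sym parent≡) j<k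
    ... | no  k≮n = subst (_< k) (sym (cong (proj₂ ∘ front) (inactive (≮⇒≥ k≮n)))) 0<k

    accepted-state : ∀ j → accepted (state j) ≡ ∑ 0 j (𝟙 ∘ grows)
    accepted-state zero    = refl
    accepted-state (suc j) = begin
      accepted (state (suc j))                       ≡⟨ accepted-advance j (δ j) (state j) ⟩
      accepted (state j) + 𝟙 (grows j)               ≡⟨ cong (_+ 𝟙 (grows j)) (accepted-state j) ⟩
      ∑ 0 j (𝟙 ∘ grows) + 𝟙 (grows j)                ≡⟨ cong (∑ 0 j (𝟙 ∘ grows) +_) (sym (+-identityʳ (𝟙 (grows j)))) ⟩
      ∑ 0 j (𝟙 ∘ grows) + ∑ j 1 (𝟙 ∘ grows)          ≡⟨ sym (∑-++ 0 j 1 (𝟙 ∘ grows)) ⟩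
      ∑ 0 (j + 1) (𝟙 ∘ grows)                        ≡⟨ cong (λ l → ∑ 0 l (𝟙 ∘ grows)) (+-comm j 1) ⟩
      ∑ 0 (suc j) (𝟙 ∘ grows)                        ∎
      where open ≡-Reasoning

    open ParentTree n parent parent< using (_IsParentOf_; input; closed?; closedᵇ⇒; ⇒closedᵇ; map-toℕ-closedNbrs)

    children-of : ∀ {i z} → i < n → z ∈ applyUpTo (firstChild i +_) (deg i) → z < n × i IsParentOf z
    children-of {i} i<n z∈ =
      let o , o<deg , z≡fc+o = ∈-applyUpTo⁻ (firstChild i +_) z∈
          κ , child = <⇒! (children (kind i) (grows i)) (subst (o <_) (sym (length-children (kind i) (grows i))) o<deg)
          0<z , z<n = child-bounds i<n child
      in subst (_< n) (sym z≡fc+o) z<n , subst (0 <_) (sym z≡fc+o) 0<z , subst (λ z → parent z ≡ i) (sym z≡fc+o) (proj₂ (childAt i<n child))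

    ∈-children : ∀ {i z} → z < n → i IsParentOf z → z ∈ applyUpTo (firstChild i +_) (deg i)
    ∈-children {i} {z} z<n (0<z , pz≡i) =
      let j , o , _ , z≡fc+o , o<deg , pz≡j , _ = placement 0<z z<n in
      subst (λ k → z ∈ applyUpTo (firstChild k +_) (deg k)) (trans (sym pz≡j) pz≡i)
        (subst (_∈ applyUpTo (firstChild j +_) (deg j)) (sym z≡fc+o) (∈-applyUpTo⁺ (firstChild j +_) o<deg))

    Closed : ℕ → ℕ → Set
    Closed i z = i ≡ z ⊎ i IsParentOf z ⊎ z IsParentOf i

    neighbours⊆ : ∀ {i z} → i < n → z ∈ neighbours i (state i) → z < n × Closed i z
    neighbours⊆ {zero}  i<n (here refl)         = i<n , inj₁ refl
    neighbours⊆ {zero}  i<n (there z∈)          = Data.Product.map₂ (inj₂ ∘ inj₁) (children-of i<n z∈)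
    neighbours⊆ {suc i} i<n (here refl)         = <-trans (parent< z<s) i<n , inj₂ (inj₂ (z<s , refl))
    neighbours⊆ {suc i} i<n (there (here refl)) = i<n , inj₁ refl
    neighbours⊆ {suc i} i<n (there (there z∈))  = Data.Product.map₂ (inj₂ ∘ inj₁) (children-of i<n z∈)

    ⊆neighbours : ∀ {i z} → z < n → Closed i z → z ∈ neighbours i (state i)
    ⊆neighbours {zero}  _   (inj₁ refl)                = here refl
    ⊆neighbours {suc i} _   (inj₁ refl)                = there (here refl)
    ⊆neighbours {zero}  z<n (inj₂ (inj₁ i∣z))          = there (∈-children z<n i∣z)
    ⊆neighbours {suc i} z<n (inj₂ (inj₁ i∣z))          = there (there (∈-children z<n i∣z))
    ⊆neighbours {suc i} _   (inj₂ (inj₂ (_ , refl)))   = here refl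

    children-sorted : ∀ i → AllPairs _<_ (applyUpTo (firstChild i +_) (deg i))
    children-sorted i = AllPairs.applyUpTo⁺₁ (firstChild i +_) (deg i) (λ o<o′ _ → +-monoʳ-< (firstChild i) o<o′)

    i<children : ∀ {i} → i < n → All (i <_) (applyUpTo (firstChild i +_) (deg i))
    i<children {i} i<n = All.applyUpTo⁺₁ (firstChild i +_) (deg i) (λ {o} _ → <-≤-trans (j<firstChild i<n) (m≤m+n _ o))

    neighbours-sorted : ∀ {i} → i < n → AllPairs _<_ (neighbours i (state i))
    neighbours-sorted {zero}  i<n = i<children i<n ∷ children-sorted zero
    neighbours-sorted {suc i} i<n =
      (p<i ∷ All.map (<-trans p<i) (i<children i<n)) ∷ i<children i<n ∷ children-sorted (suc i)
      where p<i = parent< {suc i} z<s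

    observe-input : ∀ v → observe input v ≡ observation (toℕ v)
    observe-input v = cong (λ zs → toℕ v , sort zs) (begin
      map toℕ (closedNbrs input v)       ≡⟨ map-toℕ-closedNbrs v ⟩
      filter (closed? i) (upTo n)        ≡⟨ strictlySorted-≡ (AllPairs.filter⁺ (closed? i) (upTo-strictlySorted n)) (neighbours-sorted i<n)
                                              (λ z∈ → let z∈upTo , closed = ∈-filter⁻ (closed? i) {xs = upTo n} z∈
                                                      in ⊆neighbours (∈-upTo⁻ z∈upTo) (closedᵇ⇒ i _ closed))
                                              (λ z∈ → let z<n , closed = neighbours⊆ i<n z∈
                                                      in ∈-filter⁺ (closed? i) (∈-upTo⁺ z<n) (⇒closedᵇ closed)) ⟩
      neighbours i (state i)             ∎)
      where open ≡-Reasoning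
            i = toℕ v
            i<n = toℕ<n v

    history-input : ∀ v → history input v ≡ transcript δ (toℕ v)
    history-input = history-≡ input observation observe-input

  internal : Kind → Bool
  internal leaf = false
  internal _    = true

  isQuery : Kind → Bool
  isQuery query = true
  isQuery _     = false

  hubWeight : Kind → ℕ
  hubWeight hub = K
  hubWeight _   = 0

  rejects : Kind → Bool → Bool
  rejects query b = not b
  rejects _     _ = false

  hubWeight-children : ∀ κ g → sum (map hubWeight (children κ g)) ≡ 0
  hubWeight-children hub   _     = trans (sum-map-replicate hubWeight K query) (*-zeroʳ K)
  hubWeight-children leaf  _     = refl
  hubWeight-children fork  _     = refl
  hubWeight-children query true  = refl
  hubWeight-children query false = refl

  internal-children : ∀ κ b a → let g = accepts κ b a in sum (map (𝟙 ∘ internal) (children κ g)) ≡ hubWeight κ + (𝟙 g + 𝟙 g)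
  internal-children hub   b a = trans (sum-map-replicate (𝟙 ∘ internal) K query) (trans (*-identityʳ K) (sym (+-identityʳ K)))
  internal-children leaf  b a = refl
  internal-children fork  b a = refl
  internal-children query b a with b ∧ (a <ᵇ B)
  ... | true  = refl
  ... | false = refl

  query-children : ∀ κ b a → sum (map (𝟙 ∘ isQuery) (children κ (accepts κ b a))) ≡ hubWeight κ + 𝟙 (accepts κ b a)
  query-children hub   b a = trans (sum-map-replicate (𝟙 ∘ isQuery) K query) (trans (*-identityʳ K) (sym (+-identityʳ K)))
  query-children leaf  b a = refl
  query-children fork  b a = refl
  query-children query b a with b ∧ (a <ᵇ B)
  ... | true  = refl
  ... | false = refl

  -- The core vertices (internal, and not a grown query) will form a minimum dominating set.
  inCore : Kind → Bool → ℕ → Bool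
  inCore κ b a = internal κ ∧ not (accepts κ b a)

  internal-split : ∀ κ b a → 𝟙 (internal κ) ≡ 𝟙 (inCore κ b a) + 𝟙 (accepts κ b a)
  internal-split hub   b a = refl
  internal-split leaf  b a = refl
  internal-split fork  b a = refl
  internal-split query b a with b ∧ (a <ᵇ B)
  ... | true  = refl
  ... | false = refl

  query-split : ∀ κ b a → a < B → 𝟙 (isQuery κ) ≡ 𝟙 (accepts κ b a) + 𝟙 (rejects κ b)
  query-split hub   b a _   = refl
  query-split leaf  b a _   = refl
  query-split fork  b a _   = refl
  query-split query b a a<B rewrite Equivalence.to Data.Bool.Properties.T-≡ (<⇒<ᵇ a<B) with b
  ... | true  = refl
  ... | false = refl

  ¬internal⇒leaf : ∀ κ → internal κ ≡ false → κ ≡ leaf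
  ¬internal⇒leaf leaf _ = refl

  leaf-child⇒core : ∀ κ b a {o} → children κ (accepts κ b a) ! o ≡ just leaf → inCore κ b a ≡ true
  leaf-child⇒core hub   b a _ = refl
  leaf-child⇒core fork  b a _ = refl
  leaf-child⇒core query b a {o} child with b ∧ (a <ᵇ B)
  leaf-child⇒core query b a {zero}        () | true
  leaf-child⇒core query b a {suc zero}    () | true
  leaf-child⇒core query b a {suc (suc _)} () | true
  ... | false = refl

  core⇒leaf-child : ∀ κ b a → inCore κ b a ≡ true → children κ (accepts κ b a) ! 0 ≡ just leaf
  core⇒leaf-child hub   b a _ = refl
  core⇒leaf-child fork  b a _ = refl
  core⇒leaf-child query b a core with b ∧ (a <ᵇ B)
  ... | false = refl

  accepts⇒fork-child : ∀ κ b a → accepts κ b a ≡ true → children κ (accepts κ b a) ! 0 ≡ just fork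
  accepts⇒fork-child query b a accept rewrite accept = refl

  -- The tree depends on the answers and the answers on the tree; the knot is tied step by step, since
  -- the answer at step t only depends on the transcript up to t, hence only on earlier answers.
  module Answers (A : OnlineAlg) where

    decisions : ℕ → ℕ → Bool
    decisions zero    k = false
    decisions (suc t) k with k ≟ t
    ... | yes _ = A (transcript (decisions t) t)
    ... | no  _ = decisions t k

    answer : ℕ → Bool
    answer k = decisions (suc k) k

    decisions-last : ∀ t → decisions (suc t) t ≡ A (transcript (decisions t) t)
    decisions-last t with t ≟ t
    ... | yes _  = refl
    ... | no t≢t = ⊥-elim (t≢t refl)

    decisions-answer : ∀ t {k} → k < t → decisions t k ≡ answer k
    decisions-answer (suc t) {k} k<1+t with k ≟ t
    ... | yes refl = sym (decisions-last k)
    ... | no  k≢t  = decisions-answer t (≤∧≢⇒< (≤-pred k<1+t) k≢t)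

    answer-consistent : ∀ t → answer t ≡ A (transcript answer t)
    answer-consistent t = trans (decisions-last t) (cong A (transcript-local (decisions t) answer t (decisions-answer t)))

  module Cost (δ : ℕ → Bool) where
    open Run δ
    open ParentTree n parent parent< using (graph; edgeᵇ; parent⇒edgeᵇ; child⇒edgeᵇ; edgeᵇ⇒)

    grown : ℕ
    grown = ∑ 0 n (𝟙 ∘ grows)

    children-∑ : ∀ {j} → j < n → ∀ f → ∑ (firstChild j) (deg j) (f ∘ kind) ≡ sum (map f (children (kind j) (grows j)))
    children-∑ {j} j<n f =
      subst (λ l → ∑ (firstChild j) l (f ∘ kind) ≡ sum (map f (children (kind j) (grows j))))
            (length-children (kind j) (grows j))
            (∑-list (f ∘ kind) f (children (kind j) (grows j)) (firstChild j) (cong f ∘ proj₁ ∘ childAt j<n))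

    -- The vertices other than the root are tiled by the blocks of children of the vertices below n.
    ∑-tiled : ∀ g → ∑ 0 n g ≡ g 0 + ∑ 0 n (λ j → ∑ (firstChild j) (deg j) g)
    ∑-tiled g = begin
      ∑ 0 n g                                       ≡⟨ cong (λ l → ∑ 0 l g) n≡1+∑deg ⟩
      g 0 + ∑ 1 (∑ 0 n deg) g                        ≡⟨ cong (g 0 +_) (sym (∑-blocks firstChild deg g 0 n tiles)) ⟩
      g 0 + ∑ 0 n (λ j → ∑ (firstChild j) (deg j) g) ∎
      where
      open ≡-Reasoning
      tiles : OnRange 0 n (λ j → firstChild (suc j) ≡ firstChild j + deg j)
      tiles j _ j<n = firstChild-suc j<n
      n≡1+∑deg : n ≡ suc (∑ 0 n deg)
      n≡1+∑deg = begin
        n                  ≡⟨ sym (+-identityʳ n) ⟩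
        n + 0              ≡⟨ cong (λ q → n + length q) (sym queue-n) ⟩
        firstChild n       ≡⟨ blocks-end firstChild deg 0 n tiles ⟩
        suc (∑ 0 n deg)    ∎

    ∑-kinds : ∀ f → ∑ 0 n (f ∘ kind) ≡ f hub + ∑ 0 n (λ j → sum (map f (children (kind j) (grows j))))
    ∑-kinds f = trans (∑-tiled (f ∘ kind)) (cong (f hub +_) (∑-cong 0 n (λ j _ j<n → children-∑ j<n f)))

    hubWeight-total : ∑ 0 n (hubWeight ∘ kind) ≡ K
    hubWeight-total = begin
      ∑ 0 n (hubWeight ∘ kind)                                              ≡⟨ ∑-kinds hubWeight ⟩
      K + ∑ 0 n (λ j → sum (map hubWeight (children (kind j) (grows j))))    ≡⟨ cong (K +_) (∑-zero 0 n (λ j _ _ → hubWeight-children (kind j) (grows j))) ⟩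
      K + 0                                                                 ≡⟨ +-identityʳ K ⟩
      K                                                                     ∎
      where open ≡-Reasoning

    internal-total : ∑ 0 n (𝟙 ∘ internal ∘ kind) ≡ 1 + (K + (grown + grown))
    internal-total = begin
      ∑ 0 n (𝟙 ∘ internal ∘ kind)                                  ≡⟨ ∑-kinds (𝟙 ∘ internal) ⟩
      1 + ∑ 0 n (λ j → sum (map (𝟙 ∘ internal) (children (kind j) (grows j))))
                                                                    ≡⟨ cong (1 +_) (∑-cong 0 n (λ j _ _ → internal-children (kind j) (δ j) (accepted (state j)))) ⟩
      1 + ∑ 0 n (λ j → hubWeight (kind j) + (𝟙 (grows j) + 𝟙 (grows j)))
                                                                    ≡⟨ cong (1 +_) (∑-distrib-+ 0 n _ _) ⟩
      1 + (∑ 0 n (hubWeight ∘ kind) + ∑ 0 n (λ j → 𝟙 (grows j) + 𝟙 (grows j)))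
                                                                    ≡⟨ cong₂ (λ x y → 1 + (x + y)) hubWeight-total (∑-distrib-+ 0 n _ _) ⟩
      1 + (K + (grown + grown))                                     ∎
      where open ≡-Reasoning

    query-total : ∑ 0 n (𝟙 ∘ isQuery ∘ kind) ≡ K + grown
    query-total = begin
      ∑ 0 n (𝟙 ∘ isQuery ∘ kind)                                   ≡⟨ ∑-kinds (𝟙 ∘ isQuery) ⟩
      ∑ 0 n (λ j → sum (map (𝟙 ∘ isQuery) (children (kind j) (grows j))))
                                                                    ≡⟨ ∑-cong 0 n (λ j _ _ → query-children (kind j) (δ j) (accepted (state j))) ⟩
      ∑ 0 n (λ j → hubWeight (kind j) + 𝟙 (grows j))                ≡⟨ ∑-distrib-+ 0 n _ _ ⟩
      ∑ 0 n (hubWeight ∘ kind) + grown                              ≡⟨ cong (_+ grown) hubWeight-total ⟩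
      K + grown                                                     ∎
      where open ≡-Reasoning

    core : ℕ → Bool
    core j = inCore (kind j) (δ j) (accepted (state j))

    core-total : ∑ 0 n (𝟙 ∘ core) ≡ 1 + K + grown
    core-total = +-cancelʳ-≡ grown _ _ (begin
      ∑ 0 n (𝟙 ∘ core) + grown                  ≡⟨ sym (∑-distrib-+ 0 n _ _) ⟩
      ∑ 0 n (λ j → 𝟙 (core j) + 𝟙 (grows j))    ≡⟨ ∑-cong 0 n (λ j _ _ → sym (internal-split (kind j) (δ j) (accepted (state j)))) ⟩
      ∑ 0 n (𝟙 ∘ internal ∘ kind)               ≡⟨ internal-total ⟩
      1 + (K + (grown + grown))                 ≡⟨ cong suc (sym (+-assoc K grown grown)) ⟩
      1 + K + grown + grown                     ∎)
      where open ≡-Reasoning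

    accepted≤grown : ∀ {j} → j ≤ n → accepted (state j) ≤ grown
    accepted≤grown {j} j≤n = begin
      accepted (state j)                            ≡⟨ accepted-state j ⟩
      ∑ 0 j (𝟙 ∘ grows)                             ≤⟨ m≤m+n _ _ ⟩
      ∑ 0 j (𝟙 ∘ grows) + ∑ j (n ∸ j) (𝟙 ∘ grows)   ≡⟨ sym (∑-++ 0 j (n ∸ j) (𝟙 ∘ grows)) ⟩
      ∑ 0 (j + (n ∸ j)) (𝟙 ∘ grows)                 ≡⟨ cong (λ l → ∑ 0 l (𝟙 ∘ grows)) (m+[n∸m]≡n j≤n) ⟩
      grown                                         ∎
      where open ≤-Reasoning

    rejected : ℕ
    rejected = ∑ 0 n (λ j → 𝟙 (rejects (kind j) (δ j)))

    -- While the budget lasts, every query is either accepted and grown, or rejected.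
    rejected-total : grown < B → rejected ≡ K
    rejected-total grown<B = +-cancelˡ-≡ grown _ _ (begin
      grown + rejected                                             ≡⟨ sym (∑-distrib-+ 0 n _ _) ⟩
      ∑ 0 n (λ j → 𝟙 (grows j) + 𝟙 (rejects (kind j) (δ j)))       ≡⟨ ∑-cong 0 n (λ j _ j<n → sym (query-split (kind j) (δ j) _ (budget-open j<n))) ⟩
      ∑ 0 n (𝟙 ∘ isQuery ∘ kind)                                   ≡⟨ query-total ⟩
      K + grown                                                    ≡⟨ +-comm K grown ⟩
      grown + K                                                    ∎)
      where
      open ≡-Reasoning
      budget-open : ∀ {j} → j < n → accepted (state j) < B
      budget-open j<n = ≤-<-trans (accepted≤grown (<⇒≤ j<n)) grown<B

    module _ (S : Subset n) where

      leafCount : ℕ → ℕ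
      leafCount k = 𝟙 (not (internal (kind k)) ∧ member S k)

      -- An internal vertex is charged for itself and for its selected leaf children.
      local : ℕ → ℕ
      local j = 𝟙 (internal (kind j) ∧ member S j) + ∑ (firstChild j) (deg j) leafCount

      ∣S∣≡∑local : ∣ S ∣ ≡ ∑ 0 n local
      ∣S∣≡∑local = begin
        ∣ S ∣                                                        ≡⟨ ∣S∣≡∑member S ⟩
        ∑ 0 n (𝟙 ∘ member S)                                         ≡⟨ ∑-cong 0 n (λ k _ _ → 𝟙-split (internal (kind k)) (member S k)) ⟩
        ∑ 0 n (λ k → 𝟙 (internal (kind k) ∧ member S k) + leafCount k) ≡⟨ ∑-distrib-+ 0 n _ _ ⟩
        ∑ 0 n (λ k → 𝟙 (internal (kind k) ∧ member S k)) + ∑ 0 n leafCount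
                                                                     ≡⟨ cong (∑ 0 n (λ k → 𝟙 (internal (kind k) ∧ member S k)) +_) (∑-tiled leafCount) ⟩
        ∑ 0 n (λ k → 𝟙 (internal (kind k) ∧ member S k)) + ∑ 0 n (λ j → ∑ (firstChild j) (deg j) leafCount)
                                                                     ≡⟨ sym (∑-distrib-+ 0 n _ _) ⟩
        ∑ 0 n local                                                  ∎
        where open ≡-Reasoning

      module _ (dominating : Dominating graph S) where

        leaf-covered : ∀ {f} → 0 < f → f < n → kind f ≡ leaf → member S f ≡ true ⊎ member S (parent f) ≡ true
        leaf-covered {f} 0<f f<n f-leaf = case dominating (fromℕ< f<n) of λ where
          (inj₁ f∈S)             → inj₁ (subst (λ k → member S k ≡ true) (toℕ-fromℕ< f<n) (∈⇒member S _ f∈S))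
          (inj₂ (u , u∈S , u~f)) → case edgeᵇ⇒ (toℕ u) (toℕ (fromℕ< f<n)) u~f of λ where
            (inj₁ (_ , pf≡u))   → inj₂ (subst (λ k → member S k ≡ true)
                                              (sym (trans (cong parent (sym (toℕ-fromℕ< f<n))) pf≡u)) (∈⇒member S u u∈S))
            (inj₂ (0<u , pu≡f)) → ⊥-elim (parent-not-leaf 0<u (toℕ<n u) (trans (cong kind (trans pu≡f (toℕ-fromℕ< f<n))) f-leaf))

        child-covered : ∀ {j o} → j < n → children (kind j) (grows j) ! o ≡ just leaf →
                        member S (firstChild j + o) ≡ true ⊎ member S j ≡ true
        child-covered {j} {o} j<n child =
          let f-leaf , pf≡j = childAt j<n child
              0<f , f<n = child-bounds j<n child
          in Data.Sum.map₂ (subst (λ k → member S k ≡ true) pf≡j) (leaf-covered 0<f f<n f-leaf)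

        core-local : ∀ {j} → j < n → core j ≡ true → 1 ≤ local j
        core-local {j} j<n core-j = Data.Sum.[ leaf-selected , parent-selected ]′ (child-covered j<n leaf-child)
          where
          open ≤-Reasoning
          leaf-child = core⇒leaf-child (kind j) (δ j) (accepted (state j)) core-j
          f-leaf = proj₁ (childAt j<n leaf-child)
          0<deg = subst (0 <_) (length-children (kind j) (grows j)) (!⇒< (children (kind j) (grows j)) leaf-child)
          parent-selected : member S j ≡ true → 1 ≤ local j
          parent-selected j∈S = ≤-trans (≤-reflexive (sym (cong₂ (λ b c → 𝟙 (b ∧ c)) (proj₁ (∧-true (internal (kind j)) _ core-j)) j∈S)))
                                        (m≤m+n _ _)
          leaf-selected : member S (firstChild j + 0) ≡ true → 1 ≤ local j
          leaf-selected f∈S = begin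
            1                                            ≡⟨ sym (cong₂ (λ κ b → 𝟙 (not (internal κ) ∧ b)) f-leaf f∈S) ⟩
            leafCount (firstChild j + 0)                 ≡⟨ cong leafCount (+-identityʳ (firstChild j)) ⟩
            leafCount (firstChild j)                     ≤⟨ ∑-head-≤ (firstChild j) (deg j) leafCount 0<deg ⟩
            ∑ (firstChild j) (deg j) leafCount           ≤⟨ m≤n+m _ _ ⟩
            local j                                      ∎

        -- A rejected query is not selected, so both of its leaf children must be.
        rejected-local : ∀ {j} → j < n → kind j ≡ query → δ j ≡ false → member S j ≡ false → 2 ≤ local j
        rejected-local {j} j<n j-query δj≡false j∉S = ≤-trans (≤-reflexive (sym block≡2)) (m≤n+m _ _)
          where
          leaves : children (kind j) (grows j) ≡ leaf ∷ leaf ∷ []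
          leaves = cong₂ (λ κ b → children κ (accepts κ b (accepted (state j)))) j-query δj≡false
          leaf-selected : ∀ o → children (kind j) (grows j) ! o ≡ just leaf → leafCount (firstChild j + o) ≡ 1
          leaf-selected o child = case child-covered j<n child of λ where
            (inj₁ f∈S) → cong₂ (λ κ b → 𝟙 (not (internal κ) ∧ b)) (proj₁ (childAt j<n child)) f∈S
            (inj₂ j∈S) → contradiction (trans (sym j∉S) j∈S) λ ()
          block≡2 : ∑ (firstChild j) (deg j) leafCount ≡ 2
          block≡2 = trans (cong (λ l → ∑ (firstChild j) l leafCount) (cong degree j-query)) (cong₂ (λ x y → x + (y + 0))
            (trans (cong leafCount (sym (+-identityʳ (firstChild j)))) (leaf-selected 0 (cong (λ xs → xs ! 0) leaves)))
            (trans (cong leafCount (+-comm 1 (firstChild j))) (leaf-selected 1 (cong (λ xs → xs ! 1) leaves))))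

        alg-local : (∀ {j} → j < n → member S j ≡ δ j) → ∀ {j} → j < n →
                    𝟙 (internal (kind j)) + 𝟙 (rejects (kind j) (δ j)) ≤ local j
        alg-local selected {j} j<n = by-kind (kind j) refl (δ j) refl
          where
          core-of : ∀ {κ} → kind j ≡ κ → inCore κ (δ j) (accepted (state j)) ≡ true → core j ≡ true
          core-of κ≡ = subst (λ κ → inCore κ (δ j) (accepted (state j)) ≡ true) (sym κ≡)
          by-kind : ∀ κ → kind j ≡ κ → ∀ b → δ j ≡ b → 𝟙 (internal κ) + 𝟙 (rejects κ b) ≤ local j
          by-kind leaf  _   _     _  = z≤n
          by-kind hub   κ≡ _     _  = core-local j<n (core-of κ≡ refl)
          by-kind fork  κ≡ _     _  = core-local j<n (core-of κ≡ refl)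
          by-kind query κ≡ false b≡ = rejected-local j<n κ≡ b≡ (trans (selected j<n) b≡)
          by-kind query κ≡ true  b≡ =
            ≤-trans (≤-reflexive (sym (cong₂ (λ κ b → 𝟙 (internal κ ∧ b)) κ≡ (trans (selected j<n) b≡)))) (m≤m+n _ _)

    coreSet : Subset n
    coreSet = Vec.tabulate (core ∘ toℕ)

    ∣coreSet∣ : ∣ coreSet ∣ ≡ 1 + K + grown
    ∣coreSet∣ = trans (∣tabulate∣≡∑ n core) core-total

    core-∈ : ∀ {j} (j<n : j < n) → core j ≡ true → fromℕ< j<n ∈ˢ coreSet
    core-∈ {j} j<n core-j = Vec.lookup⇒[]= (fromℕ< j<n) coreSet
      (trans (Vec.lookup∘tabulate (core ∘ toℕ) (fromℕ< j<n)) (trans (cong core (toℕ-fromℕ< j<n)) core-j))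

    coreSet-dominating : Dominating graph coreSet
    coreSet-dominating v = by-core (core j) refl
      where
      j   = toℕ v
      j<n = toℕ<n v
      Adj-toℕ : ∀ {k} (k<n : k < n) → edgeᵇ k j ≡ true → Adj graph (fromℕ< k<n) v
      Adj-toℕ k<n = subst (λ i → edgeᵇ i j ≡ true) (sym (toℕ-fromℕ< k<n))
      -- A leaf is dominated by its parent, whose leaf child makes it a core vertex.
      leaf-dominated : internal (kind j) ≡ false → Σ (Fin n) λ u → u ∈ˢ coreSet × Adj graph u v
      leaf-dominated not-internal =
        let 0<j = n≢0⇒n>0 (λ j≡0 → contradiction (trans (cong (internal ∘ kind) (sym j≡0)) not-internal) λ ())
            p , _ , p<j , _ , _ , pj≡p , child = placement 0<j j<n
            p<n = <-trans p<j j<n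
            j-leaf = ¬internal⇒leaf (kind j) not-internal
        in fromℕ< p<n , core-∈ p<n (leaf-child⇒core (kind p) (δ p) (accepted (state p)) (trans child (cong just j-leaf))) ,
           Adj-toℕ p<n (parent⇒edgeᵇ (0<j , pj≡p))
      grown-dominated : grows j ≡ true → Σ (Fin n) λ u → u ∈ˢ coreSet × Adj graph u v
      grown-dominated j-grows =
        let fork-child = accepts⇒fork-child (kind j) (δ j) (accepted (state j)) j-grows
            f-fork , pf≡j = childAt j<n fork-child
            0<f , f<n = child-bounds j<n fork-child
            f = firstChild j + 0
        in fromℕ< f<n , core-∈ f<n (cong (λ κ → inCore κ (δ f) (accepted (state f))) f-fork) ,
           Adj-toℕ f<n (child⇒edgeᵇ (0<f , pf≡j))
      by-core : ∀ b → core j ≡ b → v ∈ˢ coreSet ⊎ Σ (Fin n) λ u → u ∈ˢ coreSet × Adj graph u v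
      by-core true  core-j = inj₁ (subst (_∈ˢ coreSet) (fromℕ<-toℕ v j<n) (core-∈ j<n core-j))
      by-core false core-j = inj₂ (Data.Sum.[ leaf-dominated , grown-dominated ]′ (∧-not-false _ _ core-j))

    coreSet-minimum : ∀ S → Dominating graph S → ∣ coreSet ∣ ≤ ∣ S ∣
    coreSet-minimum S dominating = begin
      ∣ coreSet ∣          ≡⟨ ∣tabulate∣≡∑ n core ⟩
      ∑ 0 n (𝟙 ∘ core)     ≤⟨ ∑-mono-≤ 0 n (λ j _ j<n → core≤local j<n (core j) refl) ⟩
      ∑ 0 n (local S)      ≡⟨ ∣S∣≡∑local S ⟨
      ∣ S ∣                ∎
      where
      open ≤-Reasoning
      core≤local : ∀ {j} → j < n → ∀ b → core j ≡ b → 𝟙 b ≤ local S j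
      core≤local j<n false _      = z≤n
      core≤local j<n true  core-j = core-local S dominating j<n core-j

    alg-bound : ∀ S → Dominating graph S → (∀ {j} → j < n → member S j ≡ δ j) → 1 + (K + (grown + grown)) + rejected ≤ ∣ S ∣
    alg-bound S dominating selected = begin
      1 + (K + (grown + grown)) + rejected                                  ≡⟨ cong (_+ rejected) internal-total ⟨
      ∑ 0 n (𝟙 ∘ internal ∘ kind) + rejected                                ≡⟨ ∑-distrib-+ 0 n _ _ ⟨
      ∑ 0 n (λ j → 𝟙 (internal (kind j)) + 𝟙 (rejects (kind j) (δ j)))     ≤⟨ ∑-mono-≤ 0 n (λ j _ j<n → alg-local S dominating selected j<n) ⟩
      ∑ 0 n (local S)                                                       ≡⟨ ∣S∣≡∑local S ⟨
      ∣ S ∣                                                                 ∎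
      where open ≤-Reasoning

ratio-bound : ∀ m K G R a → suc m ≤ K → 1 + (K + (G + G)) + R ≤ a → R ≡ K ⊎ suc m * suc K ≤ G →
              2 * suc m * (1 + K + G) < suc m * a + (1 + K + G)
ratio-bound m K G R a m<K a₀≤a cases = begin-strict
  2 * suc m * k                            <⟨ bound cases ⟩
  suc m * (1 + (K + (G + G)) + R) + k      ≤⟨ +-monoˡ-≤ k (*-monoʳ-≤ (suc m) a₀≤a) ⟩
  suc m * a + k                            ∎
  where
  open ≤-Reasoning
  k = 1 + K + G
  bound : R ≡ K ⊎ suc m * suc K ≤ G → 2 * suc m * k < suc m * (1 + (K + (G + G)) + R) + k
  bound (inj₁ refl) with m≤n⇒∃[o]m+o≡n m<K
  ... | K′ , refl = ≤-trans (m<m+n _ z<s) (≤-reflexive (sym (identity m K′ G)))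
    where identity : ∀ m K′ G → suc m * (1 + ((suc m + K′) + (G + G)) + (suc m + K′)) + (1 + (suc m + K′) + G)
                                ≡ 2 * suc m * (1 + (suc m + K′) + G) + suc (K′ + G)
          identity = solve-∀
  bound (inj₂ B≤G) with m≤n⇒∃[o]m+o≡n B≤G
  ... | G′ , refl = ≤-trans (m<m+n _ z<s) (≤-trans (≤-reflexive (sym (identity m K G′)))
                              (+-monoˡ-≤ k (*-monoʳ-≤ (suc m) (m≤m+n (1 + (K + (G + G))) R))))
    where identity : ∀ m K G′ → suc m * (1 + (K + ((suc m * suc K + G′) + (suc m * suc K + G′)))) + (1 + K + (suc m * suc K + G′))
                                ≡ 2 * suc m * (1 + K + (suc m * suc K + G′)) + suc (K + G′)
          identity = solve-∀

theorem1 : (A : OnlineAlg) → Correct A →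
    (m M : ℕ) →
    Σ Input (λ I → IsTree (Input.graph I) ×
    Σ ℕ (λ k → IsOPT (Input.graph I) k × M ≤ k ×
    2 * suc m * k < suc m * ALG A I + k))
theorem1 A correct m M =
  input , isTree , 1 + K + grown ,
  ((coreSet , coreSet-dominating , ∣coreSet∣) , λ S dom → subst (_≤ ∣ S ∣) ∣coreSet∣ (coreSet-minimum S dom)) ,
  ≤-trans (m≤m+n M (suc m)) (≤-trans (n≤1+n K) (m≤m+n (1 + K) grown)) ,
  ratio-bound m K grown rejected (ALG A input) (m≤n+m (suc m) M) (alg-bound (algSet A input) (correct input) selected) budget-cases
  where
  K = M + suc m
  open Adversary K (suc m * suc K)
  open Answers A
  open Run answer
  open Cost answer
  open ParentTree n parent parent< using (input; isTree)

  selected : ∀ {j} → j < n → member (algSet A input) j ≡ answer j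
  selected {j} j<n = begin
    member (algSet A input) j                   ≡⟨ cong (member (algSet A input)) (toℕ-fromℕ< j<n) ⟨
    member (algSet A input) (toℕ v)             ≡⟨ member-toℕ (algSet A input) v ⟩
    Vec.lookup (algSet A input) v               ≡⟨ Vec.lookup∘tabulate (λ i → A (history input i)) v ⟩
    A (history input v)                         ≡⟨ cong A (history-input v) ⟩
    A (transcript answer (toℕ v))               ≡⟨ answer-consistent (toℕ v) ⟨
    answer (toℕ v)                              ≡⟨ cong answer (toℕ-fromℕ< j<n) ⟩
    answer j                                    ∎
    where open ≡-Reasoning
          v = fromℕ< j<n

  budget-cases : rejected ≡ K ⊎ suc m * suc K ≤ grown
  budget-cases = case grown <? suc m * suc K of λ where
    (yes grown<B) → inj₁ (rejected-total grown<B)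
    (no  grown≮B) → inj₂ (≮⇒≥ grown≮B)
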